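{- Fix $N \in \mathbb{N}$. For integers $n \geq 0$, $k \geq 1$ let $c_{n, k} = \frac{2}{4^{k}}\sum_{j = 1}^{k}(-1)^{k - j}\binom{2k}{k - j}(2j)^{2n}$. Let $U = (u_{n,k})_{1\le n,k\le N}$ with $u_{n,k} = \frac{(-1)^n}{(2n)!}c_{n,k}$ and let $V = (v_{n,k})_{1\le n,k\le N}$ with \[ v_{n, k} = (-1)^{n}(2k)!\frac{2^{2(n - k)}}{n^2\binom{2n}{n}}h_{k, n} \text{ for } k \le n, \qquad v_{n,k} = 0 \text{ for } k > n, \] where $h_{1, n} = 1$ and $h_{k, n} = \sum_{j = k - 1}^{n - 1}\frac{1}{j^2}h_{k - 1, j}$ for $k \geq 2$. Define the lower triangular matrix $L = (l_{n,k}) \in \mathbb{R}^{N\times N}$ by $l_{n,k} = 2^{2k+1}\binom{k}{n-k}$ for $k \le n \le \min(2k, N)$ and $l_{n,k} = 0$ otherwise, and the diagonal matrix $D \in \mathbb{R}^{N\times N}$ by $d_{i,i} = 2^{2i+1}$. Then \[ UL = DU \quad \text{and} \quad LV = VD. \]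
   Context: Convention: $\binom{n}{k} = 0$ whenever $k < 0$ or $n < k$. (Here $V$ is the inverse of the lower triangular matrix $U$.) -}

module Defs where

open import Data.Nat as ℕ using (ℕ; zero; suc; _∸_; _≤?_; _!)
open import Data.Nat.Combinatorics using (_C_)
open import Data.Integer using (+_)
open import Data.Rational using (ℚ; 0ℚ; 1ℚ; _+_; _*_; -_; _/_; 1/_)
open import Data.Fin as F using (Fin; toℕ)
open import Relation.Nullary using (yes; no)

ℕ→ℚ : ℕ → ℚ
ℕ→ℚ n = (+ n) / 1

-- reciprocal of a natural number (only ever applied to positive numbers here)
inv : ℕ → ℚ
inv zero    = 0ℚ
inv (suc m) = (+ 1) / suc m

sgn : ℕ → ℚ
sgn zero    = 1ℚ
sgn (suc m) = - sgn m

sumTo : ℕ → (ℕ → ℚ) → ℚ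
sumTo zero    f = 0ℚ
sumTo (suc m) f = sumTo m f + f m

c : ℕ → ℕ → ℚ
c n k = ((+ 2) / 1 * inv (4 ℕ.^ k)) *
        sumTo k (λ i → let j = suc i in
          sgn (k ∸ j) * ℕ→ℚ ((2 ℕ.* k) C (k ∸ j)) * ℕ→ℚ ((2 ℕ.* j) ℕ.^ (2 ℕ.* n)))

u : ℕ → ℕ → ℚ
u n k = sgn n * inv ((2 ℕ.* n) !) * c n k

-- h_{1,n} = 1,  h_{k,n} = Σ_{j=k-1}^{n-1} h_{k-1,j} / j^2  (k ≥ 2); h_{0,n} is unused
h : ℕ → ℕ → ℚ
h zero          n = 0ℚ
h (suc zero)    n = 1ℚ
h (suc (suc k)) n =
  sumTo (n ∸ suc k) (λ i → let j = suc k ℕ.+ i in h (suc k) j * inv (j ℕ.* j))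

v : ℕ → ℕ → ℚ
v n k with k ≤? n
... | yes _ = sgn n * ℕ→ℚ ((2 ℕ.* k) !) * ℕ→ℚ (2 ℕ.^ (2 ℕ.* (n ∸ k)))
              * inv (n ℕ.* n ℕ.* ((2 ℕ.* n) C n)) * h k n
... | no  _ = 0ℚ

-- l_{n,k} = 2^{2k+1} binom(k, n-k) for k ≤ n ≤ 2k (n ≤ N automatic), 0 otherwise
l : ℕ → ℕ → ℚ
l n k with k ≤? n | n ≤? 2 ℕ.* k
... | yes _ | yes _ = ℕ→ℚ (2 ℕ.^ (2 ℕ.* k ℕ.+ 1) ℕ.* (k C (n ∸ k)))
... | _     | _     = 0ℚ

d : ℕ → ℕ → ℚ
d n k with n ℕ.≟ k
... | yes _ = ℕ→ℚ (2 ℕ.^ (2 ℕ.* n ℕ.+ 1))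
... | no  _ = 0ℚ

-- N×N matrices with rational entries, indexed by Fin N (index i ↦ i+1)
Mat : ℕ → Set
Mat N = Fin N → Fin N → ℚ

mat : (N : ℕ) → (ℕ → ℕ → ℚ) → Mat N
mat N f i j = f (suc (toℕ i)) (suc (toℕ j))

sumFin : (N : ℕ) → (Fin N → ℚ) → ℚ
sumFin zero    f = 0ℚ
sumFin (suc N) f = f F.zero + sumFin N (λ i → f (F.suc i))

_·_ : {N : ℕ} → Mat N → Mat N → Mat N
_·_ {N} A B i j = sumFin N (λ m → A i m * B m j)

U V L D : (N : ℕ) → Mat N
U N = mat N u
V N = mat N v
L N = mat N l
D N = mat N d

module Submission where

-- Both identities come from one structure.  Put α m = 2m(2m-1), β m = (2m)²,
-- let rowOp be the lower bidiagonal operator  x ↦ (α m x_{m-1} + β m x_m)_m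
-- and colOp its transpose  w ↦ (α (m+1) w_{m+1} + β m w_m)_m.  Then
--   * the rows of c satisfy  c_{n+1,·} = rowOp c_{n,·}                 (c-rec);
--   * colOp of a column of L is 4 times rowOp of a row of L        (l-intertwine),
--     a three-term identity of binomial coefficients;
--   * the columns of V satisfy  colOp v_{·,k+1} = -α(k+1) v_{·,k}   (v-colRec);
--   * summation by parts turns rowOp into colOp           (rowOp-colOp-adjoint).
-- Induction on the row index then shows that row n of c is a left eigenvector
-- of L for the eigenvalue ρ n = 2^(2n+1) (c-left-eigen), and that column k of V
-- is a right eigenvector for ρ k (v-right-eigen).  Since D = diag(ρ n), these
-- are the entries of  U L = D U  and  L V = V D.

open import Defs
open import Data.Nat as ℕ using (ℕ; zero; suc; pred; _∸_; _<_; _≤_; z≤n; s≤s; _^_; _!)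
import Data.Nat.Properties as ℕP
import Data.Nat.Tactic.RingSolver as ℕSolver
open import Data.Nat.Combinatorics using (_C_; nCk+nC[k+1]≡[n+1]C[k+1]; k>n⇒nCk≡0; nCn≡1; nC1≡n; nCk≡nC[n∸k])
open import Data.Nat.Coprimality using (1-coprimeTo) renaming (sym to coprime-sym)
import Data.Integer as ℤ
import Data.Integer.Properties as ℤP
open import Data.Rational using (ℚ; 0ℚ; 1ℚ; _+_; _*_; -_; _-_; mkℚ; _≟_)
open import Data.Rational.Properties
import Data.Rational.Unnormalised as ℚᵘ
import Data.Rational.Unnormalised.Properties as ℚᵘP
open import Data.Fin using (Fin; toℕ)
open import Data.Fin.Properties using (toℕ<n)
open import Data.Maybe using (Maybe; just; nothing)
open import Data.Product using (_×_; _,_)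
open import Relation.Nullary using (yes; no; ¬_; contradiction)
open import Relation.Binary.Definitions using (tri<; tri≈; tri>)
open import Relation.Binary.PropositionalEquality
open import Tactic.RingSolver using (solve-∀)
open import Tactic.RingSolver.Core.AlmostCommutativeRing using (AlmostCommutativeRing; fromCommutativeRing)

ℚ-ring : AlmostCommutativeRing _ _
ℚ-ring = fromCommutativeRing +-*-commutativeRing isZero
  where
  isZero : ∀ x → Maybe (0ℚ ≡ x)
  isZero x with 0ℚ ≟ x
  ... | yes p = just p
  ... | no _  = nothing

-- They are made
-- opaque so that the typechecker treats them as atoms instead of normalising
-- gcd computations; all that is used of them are the lemmas below.
opaque
  ι : ℕ → ℚ
  ι = ℕ→ℚ

  ι⁻¹ : ℕ → ℚ
  ι⁻¹ = inv

  ι-def : ∀ n → ι n ≡ ℕ→ℚ n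
  ι-def n = refl

  ι⁻¹-def : ∀ n → ι⁻¹ n ≡ inv n
  ι⁻¹-def n = refl

n/1 : ℕ → ℚ
n/1 n = mkℚ (ℤ.+ n) 0 (coprime-sym (1-coprimeTo n))

ℕ→ℚ≡n/1 : ∀ n → ℕ→ℚ n ≡ n/1 n
ℕ→ℚ≡n/1 n = normalize-coprime (coprime-sym (1-coprimeTo n))

ι-+ : ∀ a b → ι (a ℕ.+ b) ≡ ι a + ι b
ι-+ a b rewrite ι-def (a ℕ.+ b) | ι-def a | ι-def b | ℕ→ℚ≡n/1 (a ℕ.+ b) | ℕ→ℚ≡n/1 a | ℕ→ℚ≡n/1 b =
  toℚᵘ-injective (ℚᵘP.≃-trans (ℚᵘ.*≡* cross) (ℚᵘP.≃-sym (toℚᵘ-homo-+ (n/1 a) (n/1 b))))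
  where
  cross : ℤ.+ (a ℕ.+ b) ℤ.* ℤ.+ 1 ≡ (ℤ.+ a ℤ.* ℤ.+ 1 ℤ.+ ℤ.+ b ℤ.* ℤ.+ 1) ℤ.* ℤ.+ 1
  cross rewrite ℤP.*-identityʳ (ℤ.+ (a ℕ.+ b)) | ℤP.*-identityʳ (ℤ.+ a) | ℤP.*-identityʳ (ℤ.+ b)
              | ℤP.*-identityʳ (ℤ.+ a ℤ.+ ℤ.+ b) = ℤP.pos-+ a b

ι-* : ∀ a b → ι (a ℕ.* b) ≡ ι a * ι b
ι-* a b rewrite ι-def (a ℕ.* b) | ι-def a | ι-def b | ℕ→ℚ≡n/1 (a ℕ.* b) | ℕ→ℚ≡n/1 a | ℕ→ℚ≡n/1 b =
  toℚᵘ-injective (ℚᵘP.≃-trans (ℚᵘ.*≡* cross) (ℚᵘP.≃-sym (toℚᵘ-homo-* (n/1 a) (n/1 b))))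
  where
  cross : ℤ.+ (a ℕ.* b) ℤ.* ℤ.+ 1 ≡ (ℤ.+ a ℤ.* ℤ.+ b) ℤ.* ℤ.+ 1
  cross rewrite ℤP.*-identityʳ (ℤ.+ (a ℕ.* b)) | ℤP.*-identityʳ (ℤ.+ a ℤ.* ℤ.+ b) = ℤP.pos-* a b

ι-lin : ∀ a x b y → ι (a ℕ.* x ℕ.+ b ℕ.* y) ≡ ι a * ι x + ι b * ι y
ι-lin a x b y = trans (ι-+ (a ℕ.* x) (b ℕ.* y)) (cong₂ _+_ (ι-* a x) (ι-* b y))

ι-0 : ι 0 ≡ 0ℚ
ι-0 = ι-def 0

ι⁻¹-0 : ι⁻¹ 0 ≡ 0ℚ
ι⁻¹-0 = ι⁻¹-def 0

ι⁻¹-inverse : ∀ {n} → 0 < n → ι⁻¹ n * ι n ≡ 1ℚ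
ι⁻¹-inverse {suc m} _ rewrite ι⁻¹-def (suc m) | ι-def (suc m) | ℕ→ℚ≡n/1 (suc m)
  | normalize-coprime (1-coprimeTo (suc m)) = *-inverseˡ (n/1 (suc m))

ι-cancelˡ : ∀ {n} x y → 0 < n → ι n * x ≡ ι n * y → x ≡ y
ι-cancelˡ {n} x y n>0 e = begin
  x                      ≡⟨ unit x ⟩
  ι⁻¹ n * ι n * x        ≡⟨ *-assoc (ι⁻¹ n) (ι n) x ⟩
  ι⁻¹ n * (ι n * x)      ≡⟨ cong (ι⁻¹ n *_) e ⟩
  ι⁻¹ n * (ι n * y)      ≡⟨ *-assoc (ι⁻¹ n) (ι n) y ⟨
  ι⁻¹ n * ι n * y        ≡⟨ unit y ⟨
  y                      ∎
  where
  open ≡-Reasoning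
  unit : ∀ z → z ≡ ι⁻¹ n * ι n * z
  unit z = sym (trans (cong (_* z) (ι⁻¹-inverse n>0)) (*-identityˡ z))

ι⁻¹-* : ∀ a b → ι⁻¹ (a ℕ.* b) ≡ ι⁻¹ a * ι⁻¹ b
ι⁻¹-* zero b = trans ι⁻¹-0 (sym (trans (cong (_* ι⁻¹ b) ι⁻¹-0) (*-zeroˡ (ι⁻¹ b))))
ι⁻¹-* (suc a) zero rewrite ℕP.*-zeroʳ a =
  trans ι⁻¹-0 (sym (trans (cong (ι⁻¹ (suc a) *_) ι⁻¹-0) (*-zeroʳ (ι⁻¹ (suc a)))))
ι⁻¹-* (suc a) (suc b) = ι-cancelˡ _ _ ab>0 (begin
  ι ab * ι⁻¹ ab                          ≡⟨ trans (*-comm (ι ab) _) (ι⁻¹-inverse ab>0) ⟩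
  1ℚ                                     ≡⟨ sym (trans (cong₂ _*_ (ι⁻¹-inverse (s≤s z≤n)) (ι⁻¹-inverse (s≤s z≤n))) (*-identityˡ 1ℚ)) ⟩
  (ι⁻¹ (suc a) * ι (suc a)) * (ι⁻¹ (suc b) * ι (suc b))
    ≡⟨ shuffle (ι⁻¹ (suc a)) (ι (suc a)) (ι⁻¹ (suc b)) (ι (suc b)) ⟩
  ι (suc a) * ι (suc b) * (ι⁻¹ (suc a) * ι⁻¹ (suc b))
    ≡⟨ cong (_* (ι⁻¹ (suc a) * ι⁻¹ (suc b))) (ι-* (suc a) (suc b)) ⟨
  ι ab * (ι⁻¹ (suc a) * ι⁻¹ (suc b))     ∎)
  where
  open ≡-Reasoning
  ab = suc a ℕ.* suc b
  ab>0 : 0 < ab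
  ab>0 = s≤s z≤n
  shuffle : ∀ ia a ib b → (ia * a) * (ib * b) ≡ a * b * (ia * ib)
  shuffle = solve-∀ ℚ-ring

sum-cong : ∀ S {f g : ℕ → ℚ} → (∀ i → i < S → f i ≡ g i) → sumTo S f ≡ sumTo S g
sum-cong zero    eq = refl
sum-cong (suc S) eq = cong₂ _+_ (sum-cong S (λ i i<S → eq i (ℕP.m<n⇒m<1+n i<S))) (eq S (ℕP.n<1+n S))

sum-lin : ∀ S a b (f g : ℕ → ℚ) → sumTo S (λ i → a * f i + b * g i) ≡ a * sumTo S f + b * sumTo S g
sum-lin zero    a b f g = sym (trans (cong₂ _+_ (*-zeroʳ a) (*-zeroʳ b)) (+-identityˡ 0ℚ))
sum-lin (suc S) a b f g = trans (cong (_+ (a * f S + b * g S)) (sum-lin S a b f g))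
                                (regroup a b (sumTo S f) (sumTo S g) (f S) (g S))
  where
  regroup : ∀ a b F G x y → a * F + b * G + (a * x + b * y) ≡ a * (F + x) + b * (G + y)
  regroup = solve-∀ ℚ-ring

sum-scale : ∀ S a (f : ℕ → ℚ) → sumTo S (λ i → a * f i) ≡ a * sumTo S f
sum-scale zero    a f = sym (*-zeroʳ a)
sum-scale (suc S) a f = trans (cong (_+ a * f S) (sum-scale S a f)) (sym (*-distribˡ-+ a (sumTo S f) (f S)))

sum-shift : ∀ S (f : ℕ → ℚ) → sumTo (suc S) f ≡ f 0 + sumTo S (λ i → f (suc i))
sum-shift zero    f = trans (+-identityˡ (f 0)) (sym (+-identityʳ (f 0)))
sum-shift (suc S) f = trans (cong (_+ f (suc S)) (sum-shift S f)) (+-assoc (f 0) _ _)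

sum-zero : ∀ S {f : ℕ → ℚ} → (∀ i → i < S → f i ≡ 0ℚ) → sumTo S f ≡ 0ℚ
sum-zero S {f} vanish = trans (sum-cong S vanish) (zeros S)
  where
  zeros : ∀ S → sumTo S (λ _ → 0ℚ) ≡ 0ℚ
  zeros zero    = refl
  zeros (suc S) = trans (+-identityʳ _) (zeros S)

sum-single : ∀ S j {f : ℕ → ℚ} → j < S → (∀ i → i < S → ¬ i ≡ j → f i ≡ 0ℚ) → sumTo S f ≡ f j
sum-single (suc S) j {f} j≤S vanish with j ℕP.≟ S
... | yes refl = trans (cong (_+ f j) (sum-zero S (λ i i<j → vanish i (ℕP.m<n⇒m<1+n i<j) (ℕP.<⇒≢ i<j))))
                       (+-identityˡ (f j))
... | no j≢S   = trans (cong₂ _+_ (sum-single S j (ℕP.≤∧≢⇒< (ℕP.≤-pred j≤S) j≢S) (λ i i<S → vanish i (ℕP.m<n⇒m<1+n i<S)))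
                                  (vanish S (ℕP.n<1+n S) (λ S≡j → j≢S (sym S≡j))))
                       (+-identityʳ (f j))

sumFin-toℕ : ∀ N (g : ℕ → ℚ) → sumFin N (λ j → g (toℕ j)) ≡ sumTo N g
sumFin-toℕ zero    g = refl
sumFin-toℕ (suc N) g = trans (cong (g 0 +_) (sumFin-toℕ N (λ i → g (suc i)))) (sym (sum-shift N g))

-- Products of matrices given by 1-based entry functions.  The index is shifted
-- back to 0, which is harmless when the extra term for index 0 vanishes.
mat-product : ∀ N (f g : ℕ → ℕ → ℚ) (i j : Fin N) → let n = suc (toℕ i) ; k = suc (toℕ j) in
  f n 0 * g 0 k ≡ 0ℚ → (mat N f · mat N g) i j ≡ sumTo (suc N) (λ m → f n m * g m k)
mat-product N f g i j zeroTerm = begin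
  (mat N f · mat N g) i j                           ≡⟨ sumFin-toℕ N (λ m → f n (suc m) * g (suc m) k) ⟩
  sumTo N (λ m → f n (suc m) * g (suc m) k)         ≡⟨ +-identityˡ _ ⟨
  0ℚ + sumTo N (λ m → f n (suc m) * g (suc m) k)    ≡⟨ cong (_+ sumTo N (λ m → f n (suc m) * g (suc m) k)) zeroTerm ⟨
  f n 0 * g 0 k + sumTo N (λ m → f n (suc m) * g (suc m) k) ≡⟨ sum-shift N (λ m → f n m * g m k) ⟨
  sumTo (suc N) (λ m → f n m * g m k)               ∎
  where
  open ≡-Reasoning
  n = suc (toℕ i)
  k = suc (toℕ j)

ρ : ℕ → ℕ
ρ m = 2 ^ (2 ℕ.* m ℕ.+ 1)

ρ-suc : ∀ m → ρ (suc m) ≡ 4 ℕ.* ρ m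
ρ-suc m = trans (cong (2 ^_) (exponent m)) (ℕP.^-distribˡ-+-* 2 2 (2 ℕ.* m ℕ.+ 1))
  where
  exponent : ∀ m → 2 ℕ.* suc m ℕ.+ 1 ≡ 2 ℕ.+ (2 ℕ.* m ℕ.+ 1)
  exponent = ℕSolver.solve-∀

ιρ-suc : ∀ m → ι (ρ (suc m)) ≡ ι 4 * ι (ρ m)
ιρ-suc m = trans (cong ι (ρ-suc m)) (ι-* 4 (ρ m))

d-diag : ∀ n → d n n ≡ ι (ρ n)
d-diag n with n ℕ.≟ n
... | yes _  = sym (ι-def (ρ n))
... | no n≢n = contradiction refl n≢n

d-offdiag : ∀ n m → ¬ n ≡ m → d n m ≡ 0ℚ
d-offdiag n m n≢m with n ℕ.≟ m
... | yes n≡m = contradiction n≡m n≢m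
... | no _    = refl

diag-mulˡ : ∀ N g (i j : Fin N) → (D N · mat N g) i j ≡ ι (ρ (suc (toℕ i))) * g (suc (toℕ i)) (suc (toℕ j))
diag-mulˡ N g i j = begin
  (D N · mat N g) i j                       ≡⟨ sumFin-toℕ N (λ m → d n (suc m) * g (suc m) k) ⟩
  sumTo N (λ m → d n (suc m) * g (suc m) k) ≡⟨ sum-single N (toℕ i) (toℕ<n i) offDiag ⟩
  d n n * g n k                             ≡⟨ cong (_* g n k) (d-diag n) ⟩
  ι (ρ n) * g n k                           ∎
  where
  open ≡-Reasoning
  n = suc (toℕ i)
  k = suc (toℕ j)
  offDiag : ∀ m → m < N → ¬ m ≡ toℕ i → d n (suc m) * g (suc m) k ≡ 0ℚ
  offDiag m _ m≢i = trans (cong (_* g (suc m) k) (d-offdiag n (suc m) (λ e → m≢i (sym (ℕP.suc-injective e)))))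
                          (*-zeroˡ (g (suc m) k))

diag-mulʳ : ∀ N f (i j : Fin N) → (mat N f · D N) i j ≡ f (suc (toℕ i)) (suc (toℕ j)) * ι (ρ (suc (toℕ j)))
diag-mulʳ N f i j = begin
  (mat N f · D N) i j                       ≡⟨ sumFin-toℕ N (λ m → f n (suc m) * d (suc m) k) ⟩
  sumTo N (λ m → f n (suc m) * d (suc m) k) ≡⟨ sum-single N (toℕ j) (toℕ<n j) offDiag ⟩
  f n k * d k k                             ≡⟨ cong (f n k *_) (d-diag k) ⟩
  f n k * ι (ρ k)                           ∎
  where
  open ≡-Reasoning
  n = suc (toℕ i)
  k = suc (toℕ j)
  offDiag : ∀ m → m < N → ¬ m ≡ toℕ j → f n (suc m) * d (suc m) k ≡ 0ℚ
  offDiag m _ m≢j = trans (cong (f n (suc m) *_) (d-offdiag (suc m) k (λ e → m≢j (ℕP.suc-injective e))))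
                          (*-zeroʳ (f n (suc m)))

-- Weights of the two-term recurrences behind all three matrices:
-- α m = 2m(2m-1) and β m = (2m)².
α : ℕ → ℕ
α zero    = 0
α (suc m) = (2 ℕ.* m ℕ.+ 2) ℕ.* (2 ℕ.* m ℕ.+ 1)

β : ℕ → ℕ
β m = 4 ℕ.* (m ℕ.* m)

α-suc>0 : ∀ n → 0 < α (suc n)
α-suc>0 n = ℕP.*-mono-< {1} {2 ℕ.* n ℕ.+ 2} {0} {2 ℕ.* n ℕ.+ 1} (ℕP.m≤n+m 2 (2 ℕ.* n)) (ℕP.m≤n+m 1 (2 ℕ.* n))

rowOp : (ℕ → ℚ) → ℕ → ℚ
rowOp x m = ι (α m) * x (pred m) + ι (β m) * x m

colOp : (ℕ → ℚ) → ℕ → ℚ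
colOp w m = ι (α (suc m)) * w (suc m) + ι (β m) * w m

rowOp-colOp-boundary : ∀ S x w →
  sumTo (suc S) (λ m → rowOp x m * w m) + ι (α (suc S)) * x S * w (suc S) ≡ sumTo (suc S) (λ m → x m * colOp w m)
rowOp-colOp-boundary zero x w rewrite ι-0 = base (x 0) (w 0) (ι (α 1)) (w 1)
  where
  base : ∀ x₀ w₀ a w₁ → 0ℚ + (0ℚ * x₀ + 0ℚ * x₀) * w₀ + a * x₀ * w₁ ≡ 0ℚ + x₀ * (a * w₁ + 0ℚ * w₀)
  base = solve-∀ ℚ-ring
rowOp-colOp-boundary (suc S) x w =
  step (sumTo (suc S) (λ m → rowOp x m * w m)) _ (ι (α (suc S))) (x S) (ι (β (suc S))) (x (suc S)) (w (suc S)) (ι (α (suc (suc S)))) (w (suc (suc S)))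
       (rowOp-colOp-boundary S x w)
  where
  -- the old boundary term and the new terms combine into x_{S+1} (colOp w)_{S+1}
  step : ∀ R X a x₀ b x₁ w₁ a′ w₂ → R + a * x₀ * w₁ ≡ X →
         R + (a * x₀ + b * x₁) * w₁ + a′ * x₁ * w₂ ≡ X + x₁ * (a′ * w₂ + b * w₁)
  step R _ a x₀ b x₁ w₁ a′ w₂ refl = identity R a x₀ b x₁ w₁ a′ w₂
    where
    identity : ∀ R a x₀ b x₁ w₁ a′ w₂ →
               R + (a * x₀ + b * x₁) * w₁ + a′ * x₁ * w₂ ≡ R + a * x₀ * w₁ + x₁ * (a′ * w₂ + b * w₁)
    identity = solve-∀ ℚ-ring

rowOp-colOp-adjoint : ∀ S x w → x S ≡ 0ℚ →
  sumTo (suc S) (λ m → rowOp x m * w m) ≡ sumTo (suc S) (λ m → x m * colOp w m)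
rowOp-colOp-adjoint S x w xS≡0 = trans (sym boundary-vanishes) (rowOp-colOp-boundary S x w)
  where
  boundary-vanishes : sumTo (suc S) (λ m → rowOp x m * w m) + ι (α (suc S)) * x S * w (suc S)
                    ≡ sumTo (suc S) (λ m → rowOp x m * w m)
  boundary-vanishes rewrite xS≡0 | *-zeroʳ (ι (α (suc S))) | *-zeroˡ (w (suc S)) = +-identityʳ _

pascal : ∀ n k → n C k ℕ.+ n C suc k ≡ suc n C suc k
pascal = nCk+nC[k+1]≡[n+1]C[k+1]

C-above : ∀ {n k} → n < k → n C k ≡ 0
C-above = k>n⇒nCk≡0

-- 2(x+1) = x+1 + x+1, in the shape produced by Pascal's rule.
two-suc : ∀ x → 2 ℕ.* suc x ≡ suc (suc (2 ℕ.* x))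
two-suc = ℕSolver.solve-∀

absorption : ∀ n k → suc k ℕ.* (suc n C suc k) ≡ suc n ℕ.* (n C k)
absorption zero    zero    = refl
absorption zero    (suc k) = ℕP.*-zeroʳ (suc (suc k))
absorption (suc n) zero    = trans (ℕP.*-identityˡ _) (trans (nC1≡n (suc (suc n))) (sym (ℕP.*-identityʳ (suc (suc n)))))
absorption (suc n) (suc k) = begin
  suc (suc k) ℕ.* (suc (suc n) C suc (suc k))
    ≡⟨ cong (suc (suc k) ℕ.*_) (pascal (suc n) (suc k)) ⟨
  suc (suc k) ℕ.* (X ℕ.+ Y)
    ≡⟨ split X Y ⟩
  X ℕ.+ suc k ℕ.* X ℕ.+ suc (suc k) ℕ.* Y
    ≡⟨ cong₂ (λ a b → X ℕ.+ a ℕ.+ b) (absorption n k) (absorption n (suc k)) ⟩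
  X ℕ.+ suc n ℕ.* (n C k) ℕ.+ suc n ℕ.* (n C suc k)
    ≡⟨ merge X (n C k) (n C suc k) ⟩
  X ℕ.+ suc n ℕ.* (n C k ℕ.+ n C suc k)
    ≡⟨ cong (λ z → X ℕ.+ suc n ℕ.* z) (pascal n k) ⟩
  suc (suc n) ℕ.* X ∎
  where
  open ≡-Reasoning
  X = suc n C suc k
  Y = suc n C suc (suc k)
  split : ∀ x y → suc (suc k) ℕ.* (x ℕ.+ y) ≡ x ℕ.+ suc k ℕ.* x ℕ.+ suc (suc k) ℕ.* y
  split = ℕSolver.solve-∀
  merge : ∀ x y z → x ℕ.+ suc n ℕ.* y ℕ.+ suc n ℕ.* z ≡ x ℕ.+ suc n ℕ.* (y ℕ.+ z)
  merge = ℕSolver.solve-∀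

-- The complementary absorption:  (n+1-k) C(n+1,k) = (n+1) C(n,k), in the
-- subtraction-free form  (n+1) C(n,k) + k C(n+1,k) = (n+1) C(n+1,k).
absorption-compl : ∀ n k → suc n ℕ.* (n C k) ℕ.+ k ℕ.* (suc n C k) ≡ suc n ℕ.* (suc n C k)
absorption-compl n zero    = ℕP.+-identityʳ (suc n ℕ.* 1)
absorption-compl n (suc k) = begin
  suc n ℕ.* (n C suc k) ℕ.+ suc k ℕ.* (suc n C suc k) ≡⟨ cong (suc n ℕ.* (n C suc k) ℕ.+_) (absorption n k) ⟩
  suc n ℕ.* (n C suc k) ℕ.+ suc n ℕ.* (n C k)         ≡⟨ factor (suc n) (n C suc k) (n C k) ⟩
  suc n ℕ.* (n C k ℕ.+ n C suc k)                 ≡⟨ cong (suc n ℕ.*_) (pascal n k) ⟩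
  suc n ℕ.* (suc n C suc k)                         ∎
  where
  open ≡-Reasoning
  factor : ∀ a x y → a ℕ.* x ℕ.+ a ℕ.* y ≡ a ℕ.* (y ℕ.+ x)
  factor = ℕSolver.solve-∀

neighbour-ratio : ∀ i t → suc i ℕ.* ((i ℕ.+ t) C suc i) ≡ t ℕ.* ((i ℕ.+ t) C i)
neighbour-ratio i t with i ℕ.+ t in eq
... | zero  rewrite ℕP.m+n≡0⇒n≡0 i eq = ℕP.*-zeroʳ (suc i)
... | suc p = ℕP.+-cancelʳ-≡ (i ℕ.* X) _ _ (begin
  suc i ℕ.* (suc p C suc i) ℕ.+ i ℕ.* X ≡⟨ cong (ℕ._+ i ℕ.* X) (absorption p i) ⟩
  suc p ℕ.* (p C i) ℕ.+ i ℕ.* X         ≡⟨ absorption-compl p i ⟩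
  suc p ℕ.* X                         ≡⟨ cong (ℕ._* X) eq ⟨
  (i ℕ.+ t) ℕ.* X                     ≡⟨ ℕP.*-distribʳ-+ X i t ⟩
  i ℕ.* X ℕ.+ t ℕ.* X                 ≡⟨ ℕP.+-comm (i ℕ.* X) (t ℕ.* X) ⟩
  t ℕ.* X ℕ.+ i ℕ.* X                 ∎)
  where
  open ≡-Reasoning
  X = suc p C i

-- The identity behind the recurrence of the c_{n,k} (with K = j + r + 1):
--   j² C(2K,r+1) + 2K(2K-1) C(2K-2,r) = K² C(2K,r+1),
-- since K² - j² = (r+1)(2j+r+1).  For j = 0 it is the central recurrence.
binomial-shift : ∀ j r → let K = suc (j ℕ.+ r) in
  β j ℕ.* ((2 ℕ.* K) C suc r) ℕ.+ 4 ℕ.* α K ℕ.* ((2 ℕ.* (j ℕ.+ r)) C r) ≡ β K ℕ.* ((2 ℕ.* K) C suc r)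
binomial-shift j r = begin
  β j ℕ.* X ℕ.+ 4 ℕ.* α K ℕ.* Y      ≡⟨ cong (β j ℕ.* X ℕ.+_) (trans (ℕP.*-assoc 4 (α K) Y) (cong (4 ℕ.*_) key)) ⟩
  β j ℕ.* X ℕ.+ 4 ℕ.* (suc r ℕ.* w ℕ.* X) ≡⟨ sumSquares j r X ⟩
  β K ℕ.* X                          ∎
  where
  open ≡-Reasoning
  K = suc (j ℕ.+ r)
  M = 2 ℕ.* (j ℕ.+ r)
  X = (2 ℕ.* K) C suc r
  Y = M C r
  Z = suc M C r
  w = suc (2 ℕ.* j ℕ.+ r)
  top : suc r ℕ.* X ≡ 2 ℕ.* K ℕ.* Z
  top = subst (λ q → suc r ℕ.* (q C suc r) ≡ q ℕ.* Z) (sym (two-suc (j ℕ.+ r))) (absorption (suc M) r)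
  middle : w ℕ.* Z ≡ suc M ℕ.* Y
  middle = ℕP.+-cancelʳ-≡ (r ℕ.* Z) _ _ (begin
    w ℕ.* Z ℕ.+ r ℕ.* Z     ≡⟨ ℕP.*-distribʳ-+ Z w r ⟨
    (w ℕ.+ r) ℕ.* Z         ≡⟨ cong (ℕ._* Z) (width j r) ⟨
    suc M ℕ.* Z             ≡⟨ absorption-compl M r ⟨
    suc M ℕ.* Y ℕ.+ r ℕ.* Z ∎)
    where
    width : ∀ j r → suc (2 ℕ.* (j ℕ.+ r)) ≡ suc (2 ℕ.* j ℕ.+ r) ℕ.+ r
    width = ℕSolver.solve-∀
  key : α K ℕ.* Y ≡ suc r ℕ.* w ℕ.* X
  key = begin
    α K ℕ.* Y               ≡⟨ factorα j r Y ⟩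
    2 ℕ.* K ℕ.* (suc M ℕ.* Y) ≡⟨ cong (2 ℕ.* K ℕ.*_) middle ⟨
    2 ℕ.* K ℕ.* (w ℕ.* Z)   ≡⟨ swap (2 ℕ.* K) w Z ⟩
    w ℕ.* (2 ℕ.* K ℕ.* Z)   ≡⟨ cong (w ℕ.*_) top ⟨
    w ℕ.* (suc r ℕ.* X)     ≡⟨ swap′ w (suc r) X ⟩
    suc r ℕ.* w ℕ.* X       ∎
    where
    factorα : ∀ j r y → (2 ℕ.* (j ℕ.+ r) ℕ.+ 2) ℕ.* (2 ℕ.* (j ℕ.+ r) ℕ.+ 1) ℕ.* y ≡ 2 ℕ.* suc (j ℕ.+ r) ℕ.* (suc (2 ℕ.* (j ℕ.+ r)) ℕ.* y)
    factorα = ℕSolver.solve-∀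
    swap : ∀ a b c → a ℕ.* (b ℕ.* c) ≡ b ℕ.* (a ℕ.* c)
    swap = ℕSolver.solve-∀
    swap′ : ∀ a b c → a ℕ.* (b ℕ.* c) ≡ b ℕ.* a ℕ.* c
    swap′ = ℕSolver.solve-∀
  sumSquares : ∀ j r x → 4 ℕ.* (j ℕ.* j) ℕ.* x ℕ.+ 4 ℕ.* (suc r ℕ.* suc (2 ℕ.* j ℕ.+ r) ℕ.* x)
             ≡ 4 ℕ.* (suc (j ℕ.+ r) ℕ.* suc (j ℕ.+ r)) ℕ.* x
  sumSquares = ℕSolver.solve-∀

central-rec : ∀ n → suc n ℕ.* suc n ℕ.* ((2 ℕ.* suc n) C suc n) ≡ α (suc n) ℕ.* ((2 ℕ.* n) C n)
central-rec n = ℕP.*-cancelˡ-≡ _ _ 4 (begin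
  4 ℕ.* (suc n ℕ.* suc n ℕ.* X) ≡⟨ ℕP.*-assoc 4 (suc n ℕ.* suc n) X ⟨
  β (suc n) ℕ.* X               ≡⟨ binomial-shift 0 n ⟨
  4 ℕ.* α (suc n) ℕ.* Y         ≡⟨ ℕP.*-assoc 4 (α (suc n)) Y ⟩
  4 ℕ.* (α (suc n) ℕ.* Y)       ∎)
  where
  open ≡-Reasoning
  X = (2 ℕ.* suc n) C suc n
  Y = (2 ℕ.* n) C n

central-half : ∀ m → (2 ℕ.* suc m) C suc m ≡ 2 ℕ.* (suc (2 ℕ.* m) C m)
central-half m = begin
  (2 ℕ.* suc m) C suc m                      ≡⟨ cong (_C suc m) (two-suc m) ⟩
  suc (suc (2 ℕ.* m)) C suc m                ≡⟨ pascal (suc (2 ℕ.* m)) m ⟨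
  suc (2 ℕ.* m) C m ℕ.+ suc (2 ℕ.* m) C suc m ≡⟨ cong (suc (2 ℕ.* m) C m ℕ.+_) symmetric ⟩
  suc (2 ℕ.* m) C m ℕ.+ suc (2 ℕ.* m) C m    ≡⟨ cong (suc (2 ℕ.* m) C m ℕ.+_) (ℕP.+-identityʳ _) ⟨
  2 ℕ.* (suc (2 ℕ.* m) C m)                  ∎
  where
  open ≡-Reasoning
  symmetric : suc (2 ℕ.* m) C suc m ≡ suc (2 ℕ.* m) C m
  symmetric = trans (nCk≡nC[n∸k] (s≤s (ℕP.m≤n*m m 2)))
                    (cong (suc (2 ℕ.* m) C_) (trans (cong (_∸ m) (cong (m ℕ.+_) (ℕP.+-identityʳ m))) (ℕP.m+n∸m≡n m m)))

alternating-sum : ∀ M K → sumTo (suc K) (λ i → sgn (K ∸ i) * ι (suc M C (K ∸ i))) ≡ sgn K * ι (M C K)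
alternating-sum M zero    = +-identityˡ _
alternating-sum M (suc K) = begin
  sumTo (suc (suc K)) f                                 ≡⟨ sum-shift (suc K) f ⟩
  f 0 + sumTo (suc K) (λ i → f (suc i))                 ≡⟨ cong (f 0 +_) (alternating-sum M K) ⟩
  - sgn K * ι (suc M C suc K) + sgn K * ι (M C K)       ≡⟨ cong (λ z → - sgn K * ι z + sgn K * ι (M C K)) (pascal M K) ⟨
  - sgn K * ι (M C K ℕ.+ M C suc K) + sgn K * ι (M C K) ≡⟨ cong (λ z → - sgn K * z + sgn K * ι (M C K)) (ι-+ (M C K) (M C suc K)) ⟩
  - sgn K * (ι (M C K) + ι (M C suc K)) + sgn K * ι (M C K) ≡⟨ telescope (sgn K) (ι (M C K)) (ι (M C suc K)) ⟩
  - sgn K * ι (M C suc K)                               ∎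
  where
  open ≡-Reasoning
  f : ℕ → ℚ
  f i = sgn (suc K ∸ i) * ι (suc M C (suc K ∸ i))
  telescope : ∀ s a b → - s * (a + b) + s * a ≡ - s * b
  telescope = solve-∀ ℚ-ring

-- The matrix L.  Column m of L is ρ m times the binomial pattern
-- n ↦ C(m, n-m), which vanishes above the diagonal.

colBinom : ℕ → ℕ → ℕ
colBinom m n with m ℕ.≤? n
... | yes _ = m C (n ∸ m)
... | no  _ = 0

colBinom-above : ∀ {m n} → n < m → colBinom m n ≡ 0
colBinom-above {m} {n} n<m with m ℕ.≤? n
... | yes m≤n = contradiction m≤n (ℕP.<⇒≱ n<m)
... | no  _   = refl

colBinom-at : ∀ m i {n} → m ℕ.+ i ≡ n → colBinom m n ≡ m C i
colBinom-at m i refl with m ℕ.≤? m ℕ.+ i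
... | yes _  = cong (m C_) (ℕP.m+n∸m≡n m i)
... | no  m≰ = contradiction (ℕP.m≤m+n m i) m≰

Lℕ : ℕ → ℕ → ℕ
Lℕ n m = ρ m ℕ.* colBinom m n

l-closed : ∀ n m → l n m ≡ ι (Lℕ n m)
l-closed n m with m ℕ.≤? n | n ℕ.≤? 2 ℕ.* m
... | yes _   | yes _ = sym (ι-def _)
... | yes _   | no n≰2m = trans (sym ι-0) (cong ι (trans (sym (ℕP.*-zeroʳ (ρ m))) (cong (ρ m ℕ.*_) (sym (C-above m<n∸m)))))
  where
  m<n∸m : m < n ∸ m
  m<n∸m = subst (_< n ∸ m) (ℕP.m+n∸m≡n m m) (ℕP.∸-monoˡ-< (subst (_< n) (cong (m ℕ.+_) (ℕP.+-identityʳ m)) (ℕP.≰⇒> n≰2m))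
                                                           (ℕP.m≤m+n m m))
... | no _    | _ = trans (sym ι-0) (cong ι (sym (ℕP.*-zeroʳ (ρ m))))

l-above : ∀ {n m} → n < m → l n m ≡ 0ℚ
l-above {n} {m} n<m = trans (l-closed n m) (trans (cong ι (trans (cong (ρ m ℕ.*_) (colBinom-above n<m)) (ℕP.*-zeroʳ (ρ m)))) ι-0)

l-col0 : ∀ n → l (suc n) 0 ≡ 0ℚ
l-col0 n = trans (l-closed (suc n) 0) ι-0

-- The three-term identity of the binomial pattern in the generic range
-- i ≤ p (with n = p + 1 + i), obtained from the neighbour relations after
-- clearing the denominators (t+1)(i+1), where p = i + t.
colBinom-identity-generic : ∀ i t → let p = i ℕ.+ t ; n = suc (p ℕ.+ i) in
  α (suc n) ℕ.* (suc p C suc i) ℕ.+ β n ℕ.* (suc p C i) ≡ α (suc p) ℕ.* (p C suc i) ℕ.+ 4 ℕ.* β (suc p) ℕ.* (suc p C i)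
colBinom-identity-generic i t = ℕP.*-cancelˡ-≡ _ _ (suc t ℕ.* suc i) (begin
    suc t ℕ.* suc i ℕ.* (a ℕ.* y ℕ.+ b ℕ.* x)         ≡⟨ clear i t a b x y ⟩
    a ℕ.* suc t ℕ.* (suc i ℕ.* y) ℕ.+ b ℕ.* suc i ℕ.* (suc t ℕ.* x)
      ≡⟨ cong₂ (λ u v → a ℕ.* suc t ℕ.* u ℕ.+ b ℕ.* suc i ℕ.* v) (absorption p i) x-rel ⟩
    a ℕ.* suc t ℕ.* (suc p ℕ.* q) ℕ.+ b ℕ.* suc i ℕ.* (suc p ℕ.* q) ≡⟨ polynomial i t q ⟩
    a′ ℕ.* suc t ℕ.* (t ℕ.* q) ℕ.+ b′ ℕ.* suc i ℕ.* (suc p ℕ.* q)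
      ≡⟨ cong₂ (λ u v → a′ ℕ.* suc t ℕ.* u ℕ.+ b′ ℕ.* suc i ℕ.* v) (neighbour-ratio i t) x-rel ⟨
    a′ ℕ.* suc t ℕ.* (suc i ℕ.* z) ℕ.+ b′ ℕ.* suc i ℕ.* (suc t ℕ.* x) ≡⟨ clear i t a′ b′ x z ⟨
    suc t ℕ.* suc i ℕ.* (a′ ℕ.* z ℕ.+ b′ ℕ.* x)       ∎)
  where
  open ≡-Reasoning
  p = i ℕ.+ t
  n = suc (p ℕ.+ i)
  a = α (suc n)
  b = β n
  a′ = α (suc p)
  b′ = 4 ℕ.* β (suc p)
  x = suc p C i
  y = suc p C suc i
  z = p C suc i
  q = p C i
  -- (t+1) C(p+1,i) = (p+1) C(p,i), since p + 1 - i = t + 1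
  x-rel : suc t ℕ.* x ≡ suc p ℕ.* q
  x-rel = ℕP.+-cancelˡ-≡ (i ℕ.* x) _ _ (begin
    i ℕ.* x ℕ.+ suc t ℕ.* x     ≡⟨ ℕP.*-distribʳ-+ x i (suc t) ⟨
    (i ℕ.+ suc t) ℕ.* x         ≡⟨ cong (ℕ._* x) (ℕP.+-suc i t) ⟩
    suc p ℕ.* x                 ≡⟨ absorption-compl p i ⟨
    suc p ℕ.* q ℕ.+ i ℕ.* x     ≡⟨ ℕP.+-comm (suc p ℕ.* q) (i ℕ.* x) ⟩
    i ℕ.* x ℕ.+ suc p ℕ.* q     ∎)
  clear : ∀ i t a b x y → suc t ℕ.* suc i ℕ.* (a ℕ.* y ℕ.+ b ℕ.* x) ≡ a ℕ.* suc t ℕ.* (suc i ℕ.* y) ℕ.+ b ℕ.* suc i ℕ.* (suc t ℕ.* x)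
  clear = ℕSolver.solve-∀
  polynomial : ∀ i t q → let p = i ℕ.+ t ; n = suc (p ℕ.+ i) in
      (2 ℕ.* n ℕ.+ 2) ℕ.* (2 ℕ.* n ℕ.+ 1) ℕ.* suc t ℕ.* (suc p ℕ.* q) ℕ.+ 4 ℕ.* (n ℕ.* n) ℕ.* suc i ℕ.* (suc p ℕ.* q)
    ≡ (2 ℕ.* p ℕ.+ 2) ℕ.* (2 ℕ.* p ℕ.+ 1) ℕ.* suc t ℕ.* (t ℕ.* q) ℕ.+ 4 ℕ.* (4 ℕ.* (suc p ℕ.* suc p)) ℕ.* suc i ℕ.* (suc p ℕ.* q)
  polynomial = ℕSolver.solve-∀

-- The same identity for all i ≥ 0 (with p, n as above); for i > p the
-- binomials are mostly zero.
colBinom-identity-row : ∀ p i → let n = suc (p ℕ.+ i) in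
  α (suc n) ℕ.* (suc p C suc i) ℕ.+ β n ℕ.* (suc p C i) ≡ α (suc p) ℕ.* (p C suc i) ℕ.+ 4 ℕ.* β (suc p) ℕ.* (suc p C i)
colBinom-identity-row p i with ℕP.<-cmp i (suc p)
... | tri< i<p+1 _ _ with ℕP.m≤n⇒∃[o]m+o≡n (ℕP.≤-pred i<p+1)
...   | t , refl = colBinom-identity-generic i t
colBinom-identity-row p i | tri≈ _ refl _ = begin
  α (suc n) ℕ.* (suc p C suc i) ℕ.+ β n ℕ.* (suc p C i)
    ≡⟨ cong₂ (λ u v → α (suc n) ℕ.* u ℕ.+ β n ℕ.* v) (C-above (ℕP.n<1+n i)) (nCn≡1 i) ⟩
  α (suc n) ℕ.* 0 ℕ.+ β n ℕ.* 1
    ≡⟨ diagonal p ⟩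
  α (suc p) ℕ.* 0 ℕ.+ 4 ℕ.* β (suc p) ℕ.* 1
    ≡⟨ cong₂ (λ u v → α (suc p) ℕ.* u ℕ.+ 4 ℕ.* β (suc p) ℕ.* v) (C-above (ℕP.m<n⇒m<1+n (ℕP.n<1+n p))) (nCn≡1 i) ⟨
  α (suc p) ℕ.* (p C suc i) ℕ.+ 4 ℕ.* β (suc p) ℕ.* (suc p C i) ∎
  where
  open ≡-Reasoning
  n = suc (p ℕ.+ i)
  diagonal : ∀ p → let n = suc (p ℕ.+ suc p) in
    (2 ℕ.* n ℕ.+ 2) ℕ.* (2 ℕ.* n ℕ.+ 1) ℕ.* 0 ℕ.+ 4 ℕ.* (n ℕ.* n) ℕ.* 1
      ≡ (2 ℕ.* p ℕ.+ 2) ℕ.* (2 ℕ.* p ℕ.+ 1) ℕ.* 0 ℕ.+ 4 ℕ.* (4 ℕ.* (suc p ℕ.* suc p)) ℕ.* 1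
  diagonal = ℕSolver.solve-∀
colBinom-identity-row p i | tri> _ _ p+1<i = begin
  α (suc n) ℕ.* (suc p C suc i) ℕ.+ β n ℕ.* (suc p C i)
    ≡⟨ cong₂ (λ u v → α (suc n) ℕ.* u ℕ.+ β n ℕ.* v) (C-above (ℕP.m<n⇒m<1+n p+1<i)) (C-above p+1<i) ⟩
  α (suc n) ℕ.* 0 ℕ.+ β n ℕ.* 0
    ≡⟨ zeros (α (suc n)) (β n) (α (suc p)) (4 ℕ.* β (suc p)) ⟩
  α (suc p) ℕ.* 0 ℕ.+ 4 ℕ.* β (suc p) ℕ.* 0
    ≡⟨ cong₂ (λ u v → α (suc p) ℕ.* u ℕ.+ 4 ℕ.* β (suc p) ℕ.* v)
             (C-above (ℕP.m<n⇒m<1+n (ℕP.<-trans (ℕP.n<1+n p) p+1<i))) (C-above p+1<i) ⟨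
  α (suc p) ℕ.* (p C suc i) ℕ.+ 4 ℕ.* β (suc p) ℕ.* (suc p C i) ∎
  where
  open ≡-Reasoning
  n = suc (p ℕ.+ i)
  zeros : ∀ a b c d → a ℕ.* 0 ℕ.+ b ℕ.* 0 ≡ c ℕ.* 0 ℕ.+ d ℕ.* 0
  zeros = ℕSolver.solve-∀

colBinom-identity : ∀ p n →
  α (suc n) ℕ.* colBinom (suc p) (suc n) ℕ.+ β n ℕ.* colBinom (suc p) n
    ≡ α (suc p) ℕ.* colBinom p n ℕ.+ 4 ℕ.* β (suc p) ℕ.* colBinom (suc p) n
colBinom-identity p n with ℕP.<-cmp n p
... | tri< n<p _ _ = begin
  α (suc n) ℕ.* colBinom (suc p) (suc n) ℕ.+ β n ℕ.* colBinom (suc p) n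
    ≡⟨ cong₂ (λ u v → α (suc n) ℕ.* u ℕ.+ β n ℕ.* v) (colBinom-above (s≤s n<p)) (colBinom-above (ℕP.m<n⇒m<1+n n<p)) ⟩
  α (suc n) ℕ.* 0 ℕ.+ β n ℕ.* 0
    ≡⟨ zeros (α (suc n)) (β n) (α (suc p)) (4 ℕ.* β (suc p)) ⟩
  α (suc p) ℕ.* 0 ℕ.+ 4 ℕ.* β (suc p) ℕ.* 0
    ≡⟨ cong₂ (λ u v → α (suc p) ℕ.* u ℕ.+ 4 ℕ.* β (suc p) ℕ.* v) (colBinom-above n<p) (colBinom-above (ℕP.m<n⇒m<1+n n<p)) ⟨
  α (suc p) ℕ.* colBinom p n ℕ.+ 4 ℕ.* β (suc p) ℕ.* colBinom (suc p) n ∎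
  where
  open ≡-Reasoning
  zeros : ∀ a b c d → a ℕ.* 0 ℕ.+ b ℕ.* 0 ≡ c ℕ.* 0 ℕ.+ d ℕ.* 0
  zeros = ℕSolver.solve-∀
... | tri≈ _ refl _ = begin
  α (suc n) ℕ.* colBinom (suc n) (suc n) ℕ.+ β n ℕ.* colBinom (suc n) n
    ≡⟨ cong₂ (λ u v → α (suc n) ℕ.* u ℕ.+ β n ℕ.* v) (colBinom-at (suc n) 0 (ℕP.+-identityʳ (suc n))) (colBinom-above (ℕP.n<1+n n)) ⟩
  α (suc n) ℕ.* 1 ℕ.+ β n ℕ.* 0
    ≡⟨ diagonal (α (suc n)) (β n) (4 ℕ.* β (suc n)) ⟩
  α (suc n) ℕ.* 1 ℕ.+ 4 ℕ.* β (suc n) ℕ.* 0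
    ≡⟨ cong₂ (λ u v → α (suc n) ℕ.* u ℕ.+ 4 ℕ.* β (suc n) ℕ.* v) (colBinom-at n 0 (ℕP.+-identityʳ n)) (colBinom-above (ℕP.n<1+n n)) ⟨
  α (suc n) ℕ.* colBinom n n ℕ.+ 4 ℕ.* β (suc n) ℕ.* colBinom (suc n) n ∎
  where
  open ≡-Reasoning
  diagonal : ∀ a b c → a ℕ.* 1 ℕ.+ b ℕ.* 0 ≡ a ℕ.* 1 ℕ.+ c ℕ.* 0
  diagonal = ℕSolver.solve-∀
... | tri> _ _ p<n with ℕP.m≤n⇒∃[o]m+o≡n p<n
...   | i , refl = begin
  α (suc n) ℕ.* colBinom (suc p) (suc n) ℕ.+ β n ℕ.* colBinom (suc p) n
    ≡⟨ cong₂ (λ u v → α (suc n) ℕ.* u ℕ.+ β n ℕ.* v) (colBinom-at (suc p) (suc i) (cong suc (ℕP.+-suc p i))) (colBinom-at (suc p) i refl) ⟩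
  α (suc n) ℕ.* (suc p C suc i) ℕ.+ β n ℕ.* (suc p C i)
    ≡⟨ colBinom-identity-row p i ⟩
  α (suc p) ℕ.* (p C suc i) ℕ.+ 4 ℕ.* β (suc p) ℕ.* (suc p C i)
    ≡⟨ cong₂ (λ u v → α (suc p) ℕ.* u ℕ.+ 4 ℕ.* β (suc p) ℕ.* v) (colBinom-at p (suc i) (ℕP.+-suc p i)) (colBinom-at (suc p) i refl) ⟨
  α (suc p) ℕ.* colBinom p n ℕ.+ 4 ℕ.* β (suc p) ℕ.* colBinom (suc p) n ∎
  where
  open ≡-Reasoning

Lℕ-intertwine : ∀ n m → α (suc n) ℕ.* Lℕ (suc n) m ℕ.+ β n ℕ.* Lℕ n m ≡ 4 ℕ.* (α m ℕ.* Lℕ n (pred m) ℕ.+ β m ℕ.* Lℕ n m)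
Lℕ-intertwine zero    zero    = refl
Lℕ-intertwine (suc n) zero    = trans (cong (λ z → α (suc (suc n)) ℕ.* (ρ 0 ℕ.* z) ℕ.+ β (suc n) ℕ.* (ρ 0 ℕ.* z))
                                            (colBinom-at 0 (suc n) refl))
                                      (vanish (α (suc (suc n))) (β (suc n)))
  where
  vanish : ∀ a b → a ℕ.* (2 ℕ.* 0) ℕ.+ b ℕ.* (2 ℕ.* 0) ≡ 0
  vanish = ℕSolver.solve-∀
Lℕ-intertwine n (suc p) = begin
  α (suc n) ℕ.* (ρ (suc p) ℕ.* y) ℕ.+ β n ℕ.* (ρ (suc p) ℕ.* x)  ≡⟨ cong₂ (λ u v → α (suc n) ℕ.* (u ℕ.* y) ℕ.+ β n ℕ.* (v ℕ.* x)) (ρ-suc p) (ρ-suc p) ⟩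
  α (suc n) ℕ.* (4 ℕ.* ρ p ℕ.* y) ℕ.+ β n ℕ.* (4 ℕ.* ρ p ℕ.* x)  ≡⟨ factor (α (suc n)) (β n) (ρ p) y x ⟩
  4 ℕ.* ρ p ℕ.* (α (suc n) ℕ.* y ℕ.+ β n ℕ.* x)                  ≡⟨ cong (4 ℕ.* ρ p ℕ.*_) (colBinom-identity p n) ⟩
  4 ℕ.* ρ p ℕ.* (α (suc p) ℕ.* z ℕ.+ 4 ℕ.* β (suc p) ℕ.* x)      ≡⟨ unfactor (α (suc p)) (β (suc p)) (ρ p) z x ⟩
  4 ℕ.* (α (suc p) ℕ.* (ρ p ℕ.* z) ℕ.+ β (suc p) ℕ.* (4 ℕ.* ρ p ℕ.* x))
    ≡⟨ cong (λ u → 4 ℕ.* (α (suc p) ℕ.* (ρ p ℕ.* z) ℕ.+ β (suc p) ℕ.* (u ℕ.* x))) (ρ-suc p) ⟨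
  4 ℕ.* (α (suc p) ℕ.* (ρ p ℕ.* z) ℕ.+ β (suc p) ℕ.* (ρ (suc p) ℕ.* x)) ∎
  where
  open ≡-Reasoning
  x = colBinom (suc p) n
  y = colBinom (suc p) (suc n)
  z = colBinom p n
  factor : ∀ a b r y x → a ℕ.* (4 ℕ.* r ℕ.* y) ℕ.+ b ℕ.* (4 ℕ.* r ℕ.* x) ≡ 4 ℕ.* r ℕ.* (a ℕ.* y ℕ.+ b ℕ.* x)
  factor = ℕSolver.solve-∀
  unfactor : ∀ a b r z x → 4 ℕ.* r ℕ.* (a ℕ.* z ℕ.+ 4 ℕ.* b ℕ.* x) ≡ 4 ℕ.* (a ℕ.* (r ℕ.* z) ℕ.+ b ℕ.* (4 ℕ.* r ℕ.* x))
  unfactor = ℕSolver.solve-∀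

l-intertwine : ∀ n m → colOp (λ j → l j m) n ≡ ι 4 * rowOp (l n) m
l-intertwine n m = begin
  ι (α (suc n)) * l (suc n) m + ι (β n) * l n m
    ≡⟨ cong₂ (λ u v → ι (α (suc n)) * u + ι (β n) * v) (l-closed (suc n) m) (l-closed n m) ⟩
  ι (α (suc n)) * ι (Lℕ (suc n) m) + ι (β n) * ι (Lℕ n m)
    ≡⟨ ι-lin (α (suc n)) (Lℕ (suc n) m) (β n) (Lℕ n m) ⟨
  ι (α (suc n) ℕ.* Lℕ (suc n) m ℕ.+ β n ℕ.* Lℕ n m)
    ≡⟨ cong ι (Lℕ-intertwine n m) ⟩
  ι (4 ℕ.* (α m ℕ.* Lℕ n (pred m) ℕ.+ β m ℕ.* Lℕ n m))
    ≡⟨ trans (ι-* 4 _) (cong (ι 4 *_) (ι-lin (α m) (Lℕ n (pred m)) (β m) (Lℕ n m))) ⟩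
  ι 4 * (ι (α m) * ι (Lℕ n (pred m)) + ι (β m) * ι (Lℕ n m))
    ≡⟨ cong₂ (λ u v → ι 4 * (ι (α m) * u + ι (β m) * v)) (l-closed n (pred m)) (l-closed n m) ⟨
  ι 4 * (ι (α m) * l n (pred m) + ι (β m) * l n m) ∎
  where
  open ≡-Reasoning

-- The coefficients c_{n,k}.  Write c n k = (2/4^k) Σ_{i<k} cTerm k n i, where
-- cTerm k n i is the summand for j = i + 1.

cTerm : ℕ → ℕ → ℕ → ℚ
cTerm k n i = sgn (k ∸ suc i) * ι ((2 ℕ.* k) C (k ∸ suc i)) * ι ((2 ℕ.* suc i) ^ (2 ℕ.* n))

c-sum : ∀ n k → c n k ≡ ι 2 * ι⁻¹ (4 ^ k) * sumTo k (cTerm k n)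
c-sum n k = sym (cong₂ _*_ (cong₂ _*_ (ι-def 2) (ι⁻¹-def (4 ^ k)))
                           (sum-cong k (λ i _ → cong₂ _*_ (cong (sgn (k ∸ suc i) *_) (ι-def _)) (ι-def _))))

c-col0 : ∀ n → c n 0 ≡ 0ℚ
c-col0 n = trans (c-sum n 0) (*-zeroʳ (ι 2 * ι⁻¹ 1))

even-power-suc : ∀ j n → ι ((2 ℕ.* j) ^ (2 ℕ.* suc n)) ≡ ι (β j) * ι ((2 ℕ.* j) ^ (2 ℕ.* n))
even-power-suc j n = trans (cong ι power) (ι-* (β j) _)
  where
  power : (2 ℕ.* j) ^ (2 ℕ.* suc n) ≡ β j ℕ.* (2 ℕ.* j) ^ (2 ℕ.* n)
  power = begin
    (2 ℕ.* j) ^ (2 ℕ.* suc n)                  ≡⟨ cong ((2 ℕ.* j) ^_) (two-suc n) ⟩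
    (2 ℕ.* j) ℕ.* ((2 ℕ.* j) ℕ.* (2 ℕ.* j) ^ (2 ℕ.* n)) ≡⟨ square j ((2 ℕ.* j) ^ (2 ℕ.* n)) ⟩
    β j ℕ.* (2 ℕ.* j) ^ (2 ℕ.* n)              ∎
    where
    open ≡-Reasoning
    square : ∀ j x → 2 ℕ.* j ℕ.* (2 ℕ.* j ℕ.* x) ≡ 4 ℕ.* (j ℕ.* j) ℕ.* x
    square = ℕSolver.solve-∀

cTerm-rec : ∀ n k i → i < k → cTerm (suc k) (suc n) i ≡ ι (β (suc k)) * cTerm (suc k) n i + ι (α (suc k)) * (ι 4 * cTerm k n i)
cTerm-rec n k i i<k with ℕP.m≤n⇒∃[o]m+o≡n i<k
... | r , refl rewrite ℕP.m+n∸m≡n (suc i) r | trans (cong (_∸ i) (sym (ℕP.+-suc i r))) (ℕP.m+n∸m≡n i (suc r)) = begin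
  - s * ι X * ι ((2 ℕ.* j) ^ (2 ℕ.* suc n))        ≡⟨ cong (- s * ι X *_) (even-power-suc j n) ⟩
  - s * ι X * (ι (β j) * P)                        ≡⟨ regroup s (ι X) P (ι (β j)) (ι 4 * ι (α K) * ι Y) ⟩
  - s * P * (ι (β j) * ι X + ι 4 * ι (α K) * ι Y) + s * P * (ι 4 * ι (α K) * ι Y)
    ≡⟨ cong (λ z → - s * P * z + s * P * (ι 4 * ι (α K) * ι Y)) lifted ⟩
  - s * P * (ι (β K) * ι X) + s * P * (ι 4 * ι (α K) * ι Y) ≡⟨ distribute s P (ι X) (ι (β K)) (ι 4) (ι (α K)) (ι Y) ⟩
  ι (β K) * (- s * ι X * P) + ι (α K) * (ι 4 * (s * ι Y * P)) ∎
  where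
  open ≡-Reasoning
  j = suc i
  K = suc (j ℕ.+ r)
  s = sgn r
  X = (2 ℕ.* K) C suc r
  Y = (2 ℕ.* (j ℕ.+ r)) C r
  P = ι ((2 ℕ.* j) ^ (2 ℕ.* n))
  lifted : ι (β j) * ι X + ι 4 * ι (α K) * ι Y ≡ ι (β K) * ι X
  lifted = begin
    ι (β j) * ι X + ι 4 * ι (α K) * ι Y ≡⟨ cong (λ z → ι (β j) * ι X + z * ι Y) (ι-* 4 (α K)) ⟨
    ι (β j) * ι X + ι (4 ℕ.* α K) * ι Y ≡⟨ ι-lin (β j) X (4 ℕ.* α K) Y ⟨
    ι (β j ℕ.* X ℕ.+ 4 ℕ.* α K ℕ.* Y)   ≡⟨ cong ι (binomial-shift j r) ⟩
    ι (β K ℕ.* X)                       ≡⟨ ι-* (β K) X ⟩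
    ι (β K) * ι X                       ∎
  regroup : ∀ s x p b e → - s * x * (b * p) ≡ - s * p * (b * x + e) + s * p * e
  regroup = solve-∀ ℚ-ring
  distribute : ∀ s p x b f a y → - s * p * (b * x) + s * p * (f * a * y) ≡ b * (- s * x * p) + a * (f * (s * y * p))
  distribute = solve-∀ ℚ-ring

-- The top summand j = k has no counterpart in c_{n,k-1}.
cTerm-last : ∀ n k → cTerm (suc k) (suc n) k ≡ ι (β (suc k)) * cTerm (suc k) n k
cTerm-last n k = trans (cong (sgn (k ∸ k) * ι ((2 ℕ.* suc k) C (k ∸ k)) *_) (even-power-suc (suc k) n))
                       (swap (sgn (k ∸ k) * ι ((2 ℕ.* suc k) C (k ∸ k))) (ι (β (suc k))) (ι ((2 ℕ.* suc k) ^ (2 ℕ.* n))))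
  where
  swap : ∀ x b p → x * (b * p) ≡ b * (x * p)
  swap = solve-∀ ℚ-ring

c-rec : ∀ n k → c (suc n) k ≡ rowOp (c n) k
c-rec n zero rewrite c-col0 (suc n) | c-col0 n | ι-0 = vanish
  where
  vanish : 0ℚ ≡ 0ℚ * 0ℚ + 0ℚ * 0ℚ
  vanish = solve-∀ ℚ-ring
c-rec n (suc k) = begin
  c (suc n) (suc k)                                   ≡⟨ c-sum (suc n) (suc k) ⟩
  γ * (sumTo k (cTerm (suc k) (suc n)) + cTerm (suc k) (suc n) k)
    ≡⟨ cong₂ (λ u v → γ * (u + v)) shifted (cTerm-last n k) ⟩
  γ * (b * S + a * (ι 4 * S′) + b * t)                ≡⟨ cong (λ z → ι 2 * z * (b * S + a * (ι 4 * S′) + b * t)) (ι⁻¹-* 4 (4 ^ k)) ⟩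
  ι 2 * (ι⁻¹ 4 * ι⁻¹ (4 ^ k)) * (b * S + a * (ι 4 * S′) + b * t)
    ≡⟨ regroup (ι 2) (ι⁻¹ 4) (ι⁻¹ (4 ^ k)) b S a (ι 4) S′ t ⟩
  a * (ι 2 * ι⁻¹ (4 ^ k) * S′ * (ι⁻¹ 4 * ι 4)) + b * (ι 2 * (ι⁻¹ 4 * ι⁻¹ (4 ^ k)) * (S + t))
    ≡⟨ cong₂ (λ u v → a * (ι 2 * ι⁻¹ (4 ^ k) * S′ * u) + b * (ι 2 * v * (S + t))) (sym (ι⁻¹-inverse {4} (s≤s z≤n))) (ι⁻¹-* 4 (4 ^ k)) ⟨
  a * (ι 2 * ι⁻¹ (4 ^ k) * S′ * 1ℚ) + b * (γ * (S + t))
    ≡⟨ cong₂ (λ u v → a * u + b * v) (trans (*-identityʳ _) (sym (c-sum n k))) (sym (c-sum n (suc k))) ⟩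
  a * c n k + b * c n (suc k)                         ∎
  where
  open ≡-Reasoning
  γ = ι 2 * ι⁻¹ (4 ^ suc k)
  a = ι (α (suc k))
  b = ι (β (suc k))
  S = sumTo k (cTerm (suc k) n)
  S′ = sumTo k (cTerm k n)
  t = cTerm (suc k) n k
  shifted : sumTo k (cTerm (suc k) (suc n)) ≡ b * S + a * (ι 4 * S′)
  shifted = begin
    sumTo k (cTerm (suc k) (suc n))                                  ≡⟨ sum-cong k (cTerm-rec n k) ⟩
    sumTo k (λ i → b * cTerm (suc k) n i + a * (ι 4 * cTerm k n i))  ≡⟨ sum-lin k b a _ _ ⟩
    b * S + a * sumTo k (λ i → ι 4 * cTerm k n i)                    ≡⟨ cong (λ z → b * S + a * z) (sum-scale k (ι 4) (cTerm k n)) ⟩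
    b * S + a * (ι 4 * S′)                                           ∎
  regroup : ∀ g i4 ik b S a f S′ t → g * (i4 * ik) * (b * S + a * (f * S′) + b * t)
                                     ≡ a * (g * ik * S′ * (i4 * f)) + b * (g * (i4 * ik) * (S + t))
  regroup = solve-∀ ℚ-ring

c-row0 : ∀ K → c 0 (suc K) ≡ sgn K * ι ((2 ℕ.* suc K) C suc K) * ι⁻¹ (4 ^ suc K)
c-row0 K = begin
  c 0 (suc K)                                               ≡⟨ c-sum 0 (suc K) ⟩
  ι 2 * ι⁻¹ (4 ^ suc K) * sumTo (suc K) (cTerm (suc K) 0)   ≡⟨ cong (ι 2 * ι⁻¹ (4 ^ suc K) *_) (sum-cong (suc K) unit-power) ⟩
  ι 2 * ι⁻¹ (4 ^ suc K) * sumTo (suc K) (λ i → sgn (K ∸ i) * ι (suc M C (K ∸ i)))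
    ≡⟨ cong (ι 2 * ι⁻¹ (4 ^ suc K) *_) (alternating-sum M K) ⟩
  ι 2 * ι⁻¹ (4 ^ suc K) * (sgn K * ι (M C K))               ≡⟨ regroup (ι 2) (ι⁻¹ (4 ^ suc K)) (sgn K) (ι (M C K)) ⟩
  sgn K * (ι 2 * ι (M C K)) * ι⁻¹ (4 ^ suc K)               ≡⟨ cong (λ z → sgn K * z * ι⁻¹ (4 ^ suc K)) (trans (cong ι (central-half K)) (ι-* 2 _)) ⟨
  sgn K * ι ((2 ℕ.* suc K) C suc K) * ι⁻¹ (4 ^ suc K)       ∎
  where
  open ≡-Reasoning
  M = suc (2 ℕ.* K)
  unit-power : ∀ i → i < suc K → cTerm (suc K) 0 i ≡ sgn (K ∸ i) * ι (suc M C (K ∸ i))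
  unit-power i _ = trans (cong (sgn (K ∸ i) * ι ((2 ℕ.* suc K) C (K ∸ i)) *_) (ι-def 1))
                         (trans (*-identityʳ _) (cong (λ z → sgn (K ∸ i) * ι (z C (K ∸ i))) (two-suc K)))
  regroup : ∀ g i s x → g * i * (s * x) ≡ s * (g * x) * i
  regroup = solve-∀ ℚ-ring

c-11 : c 1 1 ≡ ι 2
c-11 = sym (ι-def 2)

c-row1-above : ∀ K → c 1 (suc (suc K)) ≡ 0ℚ
c-row1-above K = begin
  c 1 (suc (suc K))                                  ≡⟨ c-rec 0 (suc (suc K)) ⟩
  a * c 0 (suc K) + b * c 0 (suc (suc K))            ≡⟨ cong₂ (λ u v → a * u + b * v) (c-row0 K) (c-row0 (suc K)) ⟩
  a * (s * ι Y * I) + b * (- s * ι X * ι⁻¹ (4 ℕ.* 4 ^ suc K)) ≡⟨ cong (λ z → a * (s * ι Y * I) + b * (- s * ι X * z)) (ι⁻¹-* 4 (4 ^ suc K)) ⟩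
  a * (s * ι Y * I) + b * (- s * ι X * (ι⁻¹ 4 * I))  ≡⟨ regroup a s (ι Y) I b (ι X) (ι⁻¹ 4) ⟩
  s * I * (a * ι Y - ι⁻¹ 4 * (b * ι X))              ≡⟨ cong (λ z → s * I * (a * ι Y - ι⁻¹ 4 * z)) lifted ⟨
  s * I * (a * ι Y - ι⁻¹ 4 * (ι 4 * a * ι Y))        ≡⟨ regroup′ (s * I) a (ι Y) (ι⁻¹ 4) (ι 4) ⟩
  s * I * (a * ι Y - (ι⁻¹ 4 * ι 4) * (a * ι Y))      ≡⟨ cong (λ z → s * I * (a * ι Y - z * (a * ι Y))) (ι⁻¹-inverse (s≤s z≤n)) ⟩
  s * I * (a * ι Y - 1ℚ * (a * ι Y))                 ≡⟨ cancel (s * I) (a * ι Y) ⟩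
  0ℚ                                                 ∎
  where
  open ≡-Reasoning
  a = ι (α (suc (suc K)))
  b = ι (β (suc (suc K)))
  s = sgn K
  I = ι⁻¹ (4 ^ suc K)
  X = (2 ℕ.* suc (suc K)) C suc (suc K)
  Y = (2 ℕ.* suc K) C suc K
  -- the central recurrence  (2K+4)(2K+3)·4 C(2K+2,K+1) = (2K+4)² C(2K+4,K+2)
  lifted : ι 4 * a * ι Y ≡ b * ι X
  lifted = trans (cong (_* ι Y) (sym (ι-* 4 _))) (trans (sym (ι-* _ Y)) (trans (cong ι (binomial-shift 0 (suc K))) (ι-* _ X)))
  regroup : ∀ a s y i b x i4 → a * (s * y * i) + b * (- s * x * (i4 * i)) ≡ s * i * (a * y - i4 * (b * x))
  regroup = solve-∀ ℚ-ring
  regroup′ : ∀ z a y i4 f → z * (a * y - i4 * (f * a * y)) ≡ z * (a * y - (i4 * f) * (a * y))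
  regroup′ = solve-∀ ℚ-ring
  cancel : ∀ z w → z * (w - 1ℚ * w) ≡ 0ℚ
  cancel = solve-∀ ℚ-ring

c-above : ∀ n m → suc n < m → c (suc n) m ≡ 0ℚ
c-above zero    (suc (suc K)) _ = c-row1-above K
c-above zero    (suc zero) (s≤s ())
c-above (suc n) (suc m) (s≤s n+1<m) = begin
  c (suc (suc n)) (suc m)                                         ≡⟨ c-rec (suc n) (suc m) ⟩
  ι (α (suc m)) * c (suc n) m + ι (β (suc m)) * c (suc n) (suc m)
    ≡⟨ cong₂ (λ u v → ι (α (suc m)) * u + ι (β (suc m)) * v) (c-above n m n+1<m) (c-above n (suc m) (ℕP.m<n⇒m<1+n n+1<m)) ⟩
  ι (α (suc m)) * 0ℚ + ι (β (suc m)) * 0ℚ                        ≡⟨ vanish (ι (α (suc m))) (ι (β (suc m))) ⟩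
  0ℚ                                                              ∎
  where
  open ≡-Reasoning
  vanish : ∀ a b → a * 0ℚ + b * 0ℚ ≡ 0ℚ
  vanish = solve-∀ ℚ-ring

-- The
-- length S of the sum is arbitrary beyond the last nonzero entry; induction on
-- n moves rowOp across L by summation by parts and the intertwining of L.
c-left-eigen : ∀ n S k → suc n < S → sumTo S (λ m → c (suc n) m * l m k) ≡ ι (ρ (suc n)) * c (suc n) k
c-left-eigen zero S k 1<S = trans (sum-single S 1 1<S offSupport) (trans (cong (_* l 1 k) c-11) (row1 k))
  where
  offSupport : ∀ m → m < S → ¬ m ≡ 1 → c 1 m * l m k ≡ 0ℚ
  offSupport zero          _ _   = trans (cong (_* l 0 k) (c-col0 1)) (*-zeroˡ (l 0 k))
  offSupport (suc zero)    _ m≢1 = contradiction refl m≢1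
  offSupport (suc (suc K)) _ _   = trans (cong (_* l (suc (suc K)) k) (c-row1-above K)) (*-zeroˡ (l (suc (suc K)) k))
  row1 : ∀ k → ι 2 * l 1 k ≡ ι 8 * c 1 k
  row1 zero          = trans (cong (ι 2 *_) (l-col0 0)) (trans (*-zeroʳ (ι 2)) (sym (trans (cong (ι 8 *_) (c-col0 1)) (*-zeroʳ (ι 8)))))
  row1 (suc zero)    = trans (cong (ι 2 *_) (l-closed 1 1)) (trans (*-comm (ι 2) (ι 8)) (cong (ι 8 *_) (sym c-11)))
  row1 (suc (suc K)) = trans (cong (ι 2 *_) (l-above {1} {suc (suc K)} (s≤s (s≤s z≤n)))) (trans (*-zeroʳ (ι 2))
                             (sym (trans (cong (ι 8 *_) (c-row1-above K)) (*-zeroʳ (ι 8)))))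
c-left-eigen (suc n) (suc S) k (s≤s n+2≤S) = begin
  sumTo (suc S) (λ m → c (suc (suc n)) m * l m k)            ≡⟨ sum-cong (suc S) (λ m _ → cong (_* l m k) (c-rec (suc n) m)) ⟩
  sumTo (suc S) (λ m → rowOp x m * l m k)                    ≡⟨ rowOp-colOp-adjoint S x (λ m → l m k) (c-above n S n+2≤S) ⟩
  sumTo (suc S) (λ m → x m * colOp (λ j → l j k) m)          ≡⟨ sum-cong (suc S) (λ m _ → trans (cong (x m *_) (l-intertwine m k)) (expand (ι 4) a b (x m) (l m (pred k)) (l m k))) ⟩
  sumTo (suc S) (λ m → ι 4 * a * (x m * l m (pred k)) + ι 4 * b * (x m * l m k))
    ≡⟨ sum-lin (suc S) (ι 4 * a) (ι 4 * b) _ _ ⟩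
  ι 4 * a * sumTo (suc S) (λ m → x m * l m (pred k)) + ι 4 * b * sumTo (suc S) (λ m → x m * l m k)
    ≡⟨ cong₂ (λ u v → ι 4 * a * u + ι 4 * b * v) (c-left-eigen n (suc S) (pred k) n+1<S+1) (c-left-eigen n (suc S) k n+1<S+1) ⟩
  ι 4 * a * (ι (ρ (suc n)) * x (pred k)) + ι 4 * b * (ι (ρ (suc n)) * x k)  ≡⟨ collect (ι 4) (ι (ρ (suc n))) a (x (pred k)) b (x k) ⟩
  ι 4 * ι (ρ (suc n)) * rowOp x k                             ≡⟨ cong₂ _*_ (ιρ-suc (suc n)) (c-rec (suc n) k) ⟨
  ι (ρ (suc (suc n))) * c (suc (suc n)) k                    ∎
  where
  open ≡-Reasoning
  x = c (suc n)
  a = ι (α k)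
  b = ι (β k)
  n+1<S+1 : suc n < suc S
  n+1<S+1 = ℕP.m<n⇒m<1+n n+2≤S
  expand : ∀ f a b y u v → y * (f * (a * u + b * v)) ≡ f * a * (y * u) + f * b * (y * v)
  expand = solve-∀ ℚ-ring
  collect : ∀ f r a u b v → f * a * (r * u) + f * b * (r * v) ≡ f * r * (a * u + b * v)
  collect = solve-∀ ℚ-ring

h-above : ∀ k n → n ≤ suc k → h (suc (suc k)) n ≡ 0ℚ
h-above k n n≤k+1 rewrite ℕP.m≤n⇒m∸n≡0 n≤k+1 = refl

-- h_{k+1,n+1} = h_{k+1,n} + h_{k,n}/n²  for all k ≥ 0 (with h_{0,n} = 0).
h-rec : ∀ k n → h (suc k) (suc n) ≡ h (suc k) n + h k n * ι⁻¹ (n ℕ.* n)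
h-rec zero n = sym (constant (ι⁻¹ (n ℕ.* n)))
  where
  constant : ∀ x → 1ℚ + 0ℚ * x ≡ 1ℚ
  constant = solve-∀ ℚ-ring
h-rec (suc k) n with suc k ℕ.≤? n
... | yes k+1≤n with ℕP.m≤n⇒∃[o]m+o≡n k+1≤n
...   | r , refl rewrite trans (cong (_∸ k) (sym (ℕP.+-suc k r))) (ℕP.m+n∸m≡n k (suc r)) | ℕP.m+n∸m≡n (suc k) r =
  cong (sumTo r (λ i → h (suc k) (suc k ℕ.+ i) * inv ((suc k ℕ.+ i) ℕ.* (suc k ℕ.+ i))) +_)
       (cong (h (suc k) (suc k ℕ.+ r) *_) (sym (ι⁻¹-def _)))
h-rec (suc k) n | no k+1≰n = begin
  h (suc (suc k)) (suc n)                                   ≡⟨ h-above k (suc n) (s≤s n≤k) ⟩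
  0ℚ                                                        ≡⟨ +-identityˡ 0ℚ ⟨
  0ℚ + 0ℚ                                                   ≡⟨ cong₂ _+_ (h-above k n (ℕP.m≤n⇒m≤1+n n≤k)) (last k n≤k) ⟨
  h (suc (suc k)) n + h (suc k) n * ι⁻¹ (n ℕ.* n)           ∎
  where
  open ≡-Reasoning
  n≤k : n ≤ k
  n≤k = ℕP.≤-pred (ℕP.≰⇒> k+1≰n)
  last : ∀ k → n ≤ k → h (suc k) n * ι⁻¹ (n ℕ.* n) ≡ 0ℚ
  last zero    z≤n  = trans (cong (1ℚ *_) ι⁻¹-0) (*-zeroʳ 1ℚ)
  last (suc k) n≤k′ = trans (cong (_* ι⁻¹ (n ℕ.* n)) (h-above k n n≤k′)) (*-zeroˡ (ι⁻¹ (n ℕ.* n)))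

-- The entries of V in product form  v_{n,k} = (-1)^n F_k E_n h_{k,n}  with
--   F_k = (2k)!/4^k  and  E_n = 4^n / (n² C(2n,n)),
-- valid for every k ≥ 1 (both sides vanish for k > n).

F : ℕ → ℚ
F k = ι ((2 ℕ.* k) !) * ι⁻¹ (4 ^ k)

E : ℕ → ℚ
E n = ι (4 ^ n) * ι⁻¹ (n ℕ.* n ℕ.* ((2 ℕ.* n) C n))

vF : ℕ → ℕ → ℚ
vF n k = sgn n * F k * E n * h k n

vF-col0 : ∀ n → vF n 0 ≡ 0ℚ
vF-col0 n = *-zeroʳ (sgn n * F 0 * E n)

vF-row0 : ∀ k → vF 0 k ≡ 0ℚ
vF-row0 k = trans (cong (λ z → 1ℚ * F k * (ι 1 * z) * h k 0) ι⁻¹-0) (vanish (F k) (ι 1) (h k 0))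
  where
  vanish : ∀ f e x → 1ℚ * f * (e * 0ℚ) * x ≡ 0ℚ
  vanish = solve-∀ ℚ-ring

vF-above : ∀ {n k} → n < k → vF n k ≡ 0ℚ
vF-above {zero}  {k}           _           = vF-row0 k
vF-above {suc n} {suc (suc k)} (s≤s n<k+1) = trans (cong (sgn (suc n) * F (suc (suc k)) * E (suc n) *_) (h-above k (suc n) n<k+1))
                                                    (*-zeroʳ (sgn (suc n) * F (suc (suc k)) * E (suc n)))

-- The entries of V agree with the product form in every column k ≥ 1:
-- 2^{2(n-k)} / 4^n = 1/4^k.
v≡vF : ∀ n k → 0 < k → v n k ≡ vF n k
v≡vF n k k>0 with k ℕ.≤? n
... | no k≰n = sym (vF-above (ℕP.≰⇒> k≰n))
... | yes k≤n with ℕP.m≤n⇒∃[o]m+o≡n k≤n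
...   | r , refl = begin
  sgn n * ℕ→ℚ ((2 ℕ.* k) !) * ℕ→ℚ (2 ^ (2 ℕ.* (n ∸ k))) * inv δ * h k n
    ≡⟨ cong₂ (λ u w → sgn n * u * ℕ→ℚ (2 ^ (2 ℕ.* w)) * inv δ * h k n) (ι-def _) (sym (ℕP.m+n∸m≡n k r)) ⟨
  sgn n * ι ((2 ℕ.* k) !) * ℕ→ℚ (2 ^ (2 ℕ.* r)) * inv δ * h k n
    ≡⟨ cong₂ (λ u w → sgn n * ι ((2 ℕ.* k) !) * u * w * h k n) (ι-def _) (ι⁻¹-def δ) ⟨
  sgn n * ι ((2 ℕ.* k) !) * P * ι⁻¹ δ * h k n
    ≡⟨ insert-unit (sgn n) (ι ((2 ℕ.* k) !)) P (ι⁻¹ δ) (h k n) (ι⁻¹ (4 ^ k)) (ι (4 ^ k)) (ι⁻¹-inverse (ℕP.m^n>0 4 k)) ⟩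
  sgn n * ι ((2 ℕ.* k) !) * ι⁻¹ (4 ^ k) * (ι (4 ^ k) * P) * ι⁻¹ δ * h k n
    ≡⟨ cong (λ z → sgn n * ι ((2 ℕ.* k) !) * ι⁻¹ (4 ^ k) * z * ι⁻¹ δ * h k n) (trans (sym (ι-* (4 ^ k) _)) (cong ι powers)) ⟩
  sgn n * ι ((2 ℕ.* k) !) * ι⁻¹ (4 ^ k) * ι (4 ^ n) * ι⁻¹ δ * h k n
    ≡⟨ regroup (sgn n) (ι ((2 ℕ.* k) !)) (ι⁻¹ (4 ^ k)) (ι (4 ^ n)) (ι⁻¹ δ) (h k n) ⟩
  vF n k ∎
  where
  open ≡-Reasoning
  δ = n ℕ.* n ℕ.* ((2 ℕ.* n) C n)
  P = ι (2 ^ (2 ℕ.* r))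
  powers : 4 ^ k ℕ.* 2 ^ (2 ℕ.* r) ≡ 4 ^ (k ℕ.+ r)
  powers = trans (cong (4 ^ k ℕ.*_) (sym (ℕP.^-*-assoc 2 2 r))) (sym (ℕP.^-distribˡ-+-* 4 k r))
  insert-unit : ∀ s f p c x i q → i * q ≡ 1ℚ → s * f * p * c * x ≡ s * f * i * (q * p) * c * x
  insert-unit s f p c x i q iq≡1 = trans (sym (trans (cong (s * f * p * c * x *_) iq≡1) (*-identityʳ _))) (shuffle s f p c x i q)
    where
    shuffle : ∀ s f p c x i q → s * f * p * c * x * (i * q) ≡ s * f * i * (q * p) * c * x
    shuffle = solve-∀ ℚ-ring
  regroup : ∀ s f i q c x → s * f * i * q * c * x ≡ s * (f * i) * (q * c) * x
  regroup = solve-∀ ℚ-ring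

-- E_{n+1} versus E_n:  (2n+2)(2n+1) E_{n+1} = 4n² E_n  (both are 4^{n+1}/C(2n,n)).
E-rec : ∀ n → 0 < n → ι (α (suc n)) * E (suc n) ≡ ι (β n) * E n
E-rec n n>0 = trans (step-up) (sym step-down)
  where
  open ≡-Reasoning
  G = ι 4 * ι (4 ^ n) * ι⁻¹ ((2 ℕ.* n) C n)
  step-up : ι (α (suc n)) * E (suc n) ≡ G
  step-up = begin
    ι (α (suc n)) * (ι (4 ℕ.* 4 ^ n) * ι⁻¹ (suc n ℕ.* suc n ℕ.* ((2 ℕ.* suc n) C suc n)))
      ≡⟨ cong₂ (λ u w → ι (α (suc n)) * (u * ι⁻¹ w)) (ι-* 4 (4 ^ n)) (central-rec n) ⟩
    ι (α (suc n)) * (ι 4 * ι (4 ^ n) * ι⁻¹ (α (suc n) ℕ.* ((2 ℕ.* n) C n)))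
      ≡⟨ cong (λ z → ι (α (suc n)) * (ι 4 * ι (4 ^ n) * z)) (ι⁻¹-* (α (suc n)) _) ⟩
    ι (α (suc n)) * (ι 4 * ι (4 ^ n) * (ι⁻¹ (α (suc n)) * ι⁻¹ ((2 ℕ.* n) C n)))
      ≡⟨ regroup (ι (α (suc n))) (ι 4) (ι (4 ^ n)) (ι⁻¹ (α (suc n))) (ι⁻¹ ((2 ℕ.* n) C n)) ⟩
    ι⁻¹ (α (suc n)) * ι (α (suc n)) * G  ≡⟨ cong (_* G) (ι⁻¹-inverse (α-suc>0 n)) ⟩
    1ℚ * G                               ≡⟨ *-identityˡ G ⟩
    G                                    ∎
    where
    regroup : ∀ a f p i c → a * (f * p * (i * c)) ≡ i * a * (f * p * c)
    regroup = solve-∀ ℚ-ring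
  step-down : ι (β n) * E n ≡ G
  step-down = begin
    ι (4 ℕ.* (n ℕ.* n)) * (ι (4 ^ n) * ι⁻¹ (n ℕ.* n ℕ.* ((2 ℕ.* n) C n)))
      ≡⟨ cong₂ (λ u w → u * (ι (4 ^ n) * w)) (ι-* 4 (n ℕ.* n)) (ι⁻¹-* (n ℕ.* n) _) ⟩
    ι 4 * ι (n ℕ.* n) * (ι (4 ^ n) * (ι⁻¹ (n ℕ.* n) * ι⁻¹ ((2 ℕ.* n) C n)))
      ≡⟨ regroup (ι 4) (ι (n ℕ.* n)) (ι (4 ^ n)) (ι⁻¹ (n ℕ.* n)) (ι⁻¹ ((2 ℕ.* n) C n)) ⟩
    ι⁻¹ (n ℕ.* n) * ι (n ℕ.* n) * G      ≡⟨ cong (_* G) (ι⁻¹-inverse (ℕP.*-mono-< n>0 n>0)) ⟩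
    1ℚ * G                               ≡⟨ *-identityˡ G ⟩
    G                                    ∎
    where
    regroup : ∀ f q p i c → f * q * (p * (i * c)) ≡ i * q * (f * p * c)
    regroup = solve-∀ ℚ-ring

β-inv : ∀ n → 0 < n → ι (β n) * ι⁻¹ (n ℕ.* n) ≡ ι 4
β-inv n n>0 = begin
  ι (4 ℕ.* (n ℕ.* n)) * ι⁻¹ (n ℕ.* n)         ≡⟨ cong (_* ι⁻¹ (n ℕ.* n)) (ι-* 4 (n ℕ.* n)) ⟩
  ι 4 * ι (n ℕ.* n) * ι⁻¹ (n ℕ.* n)           ≡⟨ *-assoc (ι 4) (ι (n ℕ.* n)) (ι⁻¹ (n ℕ.* n)) ⟩
  ι 4 * (ι (n ℕ.* n) * ι⁻¹ (n ℕ.* n))         ≡⟨ cong (ι 4 *_) (trans (*-comm (ι (n ℕ.* n)) (ι⁻¹ (n ℕ.* n))) (ι⁻¹-inverse (ℕP.*-mono-< n>0 n>0))) ⟩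
  ι 4 * 1ℚ                                    ≡⟨ *-identityʳ (ι 4) ⟩
  ι 4                                         ∎
  where open ≡-Reasoning

F-rec : ∀ k → ι 4 * F (suc k) ≡ ι (α (suc k)) * F k
F-rec k = begin
  ι 4 * (ι ((2 ℕ.* suc k) !) * ι⁻¹ (4 ℕ.* 4 ^ k))
    ≡⟨ cong₂ (λ u w → ι 4 * (u * w)) (trans (cong ι factorial) (ι-* (α (suc k)) _)) (ι⁻¹-* 4 (4 ^ k)) ⟩
  ι 4 * (ι (α (suc k)) * ι ((2 ℕ.* k) !) * (ι⁻¹ 4 * ι⁻¹ (4 ^ k)))
    ≡⟨ regroup (ι 4) (ι (α (suc k))) (ι ((2 ℕ.* k) !)) (ι⁻¹ 4) (ι⁻¹ (4 ^ k)) ⟩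
  ι⁻¹ 4 * ι 4 * (ι (α (suc k)) * F k)  ≡⟨ cong (_* (ι (α (suc k)) * F k)) (ι⁻¹-inverse (s≤s z≤n)) ⟩
  1ℚ * (ι (α (suc k)) * F k)           ≡⟨ *-identityˡ _ ⟩
  ι (α (suc k)) * F k                  ∎
  where
  open ≡-Reasoning
  factorial : (2 ℕ.* suc k) ! ≡ α (suc k) ℕ.* (2 ℕ.* k) !
  factorial = trans (cong _! (two-suc k)) (unfold k ((2 ℕ.* k) !))
    where
    unfold : ∀ k f → suc (suc (2 ℕ.* k)) ℕ.* (suc (2 ℕ.* k) ℕ.* f) ≡ (2 ℕ.* k ℕ.+ 2) ℕ.* (2 ℕ.* k ℕ.+ 1) ℕ.* f
    unfold = ℕSolver.solve-∀
  regroup : ∀ f a x i j → f * (a * x * (i * j)) ≡ i * f * (a * (x * j))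
  regroup = solve-∀ ℚ-ring

v-colRec : ∀ k n → 0 < n → colOp (λ j → vF j (suc k)) n ≡ - (ι (α (suc k)) * vF n k)
v-colRec k n n>0 = begin
  a′ * (- s * F′ * E (suc n) * h′ (suc n)) + b * (s * F′ * E n * h′ n)
    ≡⟨ regroup a′ s F′ (E (suc n)) (h′ (suc n)) b (E n) (h′ n) ⟩
  s * F′ * (b * E n * h′ n - a′ * E (suc n) * h′ (suc n))
    ≡⟨ cong₂ (λ u w → s * F′ * (b * E n * h′ n - u * w)) (E-rec n n>0) (h-rec k n) ⟩
  s * F′ * (b * E n * h′ n - b * E n * (h′ n + h k n * ι⁻¹ (n ℕ.* n)))
    ≡⟨ difference s F′ b (E n) (h′ n) (h k n) (ι⁻¹ (n ℕ.* n)) ⟩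
  - (s * F′ * (b * ι⁻¹ (n ℕ.* n)) * E n * h k n)
    ≡⟨ cong (λ z → - (s * F′ * z * E n * h k n)) (β-inv n n>0) ⟩
  - (s * F′ * ι 4 * E n * h k n)
    ≡⟨ cong -_ (trans (pull s F′ (ι 4) (E n) (h k n)) (cong (λ z → s * z * E n * h k n) (F-rec k))) ⟩
  - (s * (ι (α (suc k)) * F k) * E n * h k n)
    ≡⟨ cong -_ (push s (ι (α (suc k))) (F k) (E n) (h k n)) ⟩
  - (ι (α (suc k)) * vF n k) ∎
  where
  open ≡-Reasoning
  s = sgn n
  a′ = ι (α (suc n))
  b = ι (β n)
  F′ = F (suc k)
  h′ = h (suc k)
  regroup : ∀ a s f e₁ x₁ b e₀ x₀ → a * (- s * f * e₁ * x₁) + b * (s * f * e₀ * x₀) ≡ s * f * (b * e₀ * x₀ - a * e₁ * x₁)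
  regroup = solve-∀ ℚ-ring
  difference : ∀ s f b e x y i → s * f * (b * e * x - b * e * (x + y * i)) ≡ - (s * f * (b * i) * e * y)
  difference = solve-∀ ℚ-ring
  pull : ∀ s f q e y → s * f * q * e * y ≡ s * (q * f) * e * y
  pull = solve-∀ ℚ-ring
  push : ∀ s a f e y → s * (a * f) * e * y ≡ a * (s * f * e * y)
  push = solve-∀ ℚ-ring

l-rows-colOp : ∀ n S (w : ℕ → ℚ) → suc n < S →
  ι (α (suc n)) * sumTo S (λ m → l (suc n) m * w m) + ι (β n) * sumTo S (λ m → l n m * w m)
    ≡ ι 4 * sumTo S (λ m → l n m * colOp w m)
l-rows-colOp n (suc S) w (s≤s n<S) = begin
  a * sumTo (suc S) (λ m → l (suc n) m * w m) + b * sumTo (suc S) (λ m → l n m * w m)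
    ≡⟨ sum-lin (suc S) a b _ _ ⟨
  sumTo (suc S) (λ m → a * (l (suc n) m * w m) + b * (l n m * w m))
    ≡⟨ sum-cong (suc S) (λ m _ → trans (factor a (l (suc n) m) b (l n m) (w m))
                                        (trans (cong (_* w m) (l-intertwine n m)) (*-assoc (ι 4) (rowOp (l n) m) (w m)))) ⟩
  sumTo (suc S) (λ m → ι 4 * (rowOp (l n) m * w m))     ≡⟨ sum-scale (suc S) (ι 4) _ ⟩
  ι 4 * sumTo (suc S) (λ m → rowOp (l n) m * w m)       ≡⟨ cong (ι 4 *_) (rowOp-colOp-adjoint S (l n) w (l-above n<S)) ⟩
  ι 4 * sumTo (suc S) (λ m → l n m * colOp w m)         ∎
  where
  open ≡-Reasoning
  a = ι (α (suc n))
  b = ι (β n)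
  factor : ∀ a x b y z → a * (x * z) + b * (y * z) ≡ (a * x + b * y) * z
  factor = solve-∀ ℚ-ring

-- Column k of V (in product form) is a right eigenvector of L with eigenvalue
-- ρ k, seen in rows n ≥ 1.  Induction on the row: the two-term column
-- recurrence of V is carried through L by l-rows-colOp.
v-right-eigen : ∀ n S k → suc n < S → sumTo S (λ m → l (suc n) m * vF m k) ≡ ι (ρ k) * vF (suc n) k
v-right-eigen zero S k 1<S = trans (sum-single S 1 1<S offSupport) (trans (cong (_* vF 1 k) (l-closed 1 1)) (row1 k))
  where
  offSupport : ∀ m → m < S → ¬ m ≡ 1 → l 1 m * vF m k ≡ 0ℚ
  offSupport zero          _ _   = trans (cong (_* vF 0 k) (l-col0 0)) (*-zeroˡ (vF 0 k))
  offSupport (suc zero)    _ m≢1 = contradiction refl m≢1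
  offSupport (suc (suc m)) _ _   = trans (cong (_* vF (suc (suc m)) k) (l-above {1} {suc (suc m)} (s≤s (s≤s z≤n)))) (*-zeroˡ (vF (suc (suc m)) k))
  both-vanish : ∀ k → vF 1 k ≡ 0ℚ → ι 8 * vF 1 k ≡ ι (ρ k) * vF 1 k
  both-vanish k v≡0 = trans (cong (ι 8 *_) v≡0) (trans (*-zeroʳ (ι 8)) (sym (trans (cong (ι (ρ k) *_) v≡0) (*-zeroʳ (ι (ρ k))))))
  row1 : ∀ k → ι 8 * vF 1 k ≡ ι (ρ k) * vF 1 k
  row1 zero          = both-vanish 0 (vF-col0 1)
  row1 (suc zero)    = refl
  row1 (suc (suc k)) = both-vanish (suc (suc k)) (vF-above {1} {suc (suc k)} (s≤s (s≤s z≤n)))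
v-right-eigen (suc n) S zero _ =
  trans (sum-zero S (λ m _ → trans (cong (l (suc (suc n)) m *_) (vF-col0 m)) (*-zeroʳ (l (suc (suc n)) m))))
        (sym (trans (cong (ι (ρ 0) *_) (vF-col0 (suc (suc n)))) (*-zeroʳ (ι (ρ 0)))))
v-right-eigen (suc n) S (suc k) n+2<S = ι-cancelˡ _ _ (α-suc>0 (suc n)) (begin
  a * X                                             ≡⟨ isolate a X b Y ⟩
  (a * X + b * Y) - b * Y                           ≡⟨ cong (_- b * Y) (l-rows-colOp (suc n) S w n+2<S) ⟩
  ι 4 * Z - b * Y                                   ≡⟨ cong₂ (λ z y → ι 4 * z - b * y) shifted (v-right-eigen n S (suc k) n+1<S) ⟩
  ι 4 * (- A * (R * vF N k)) - b * (ι (ρ (suc k)) * w N) ≡⟨ cong (λ z → ι 4 * (- A * (R * vF N k)) - b * (z * w N)) (ιρ-suc k) ⟩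
  ι 4 * (- A * (R * vF N k)) - b * (ι 4 * R * w N)  ≡⟨ collect (ι 4) A R (vF N k) b (w N) ⟩
  ι 4 * R * (- (A * vF N k) - b * w N)              ≡⟨ cong (λ z → ι 4 * R * (z - b * w N)) (v-colRec k N (s≤s z≤n)) ⟨
  ι 4 * R * (a * w (suc N) + b * w N - b * w N)     ≡⟨ cancel (ι 4 * R) a (w (suc N)) b (w N) ⟩
  a * (ι 4 * R * w (suc N))                         ≡⟨ cong (λ z → a * (z * w (suc N))) (ιρ-suc k) ⟨
  a * (ι (ρ (suc k)) * w (suc N))                   ∎)
  where
  open ≡-Reasoning
  N = suc n
  w = λ m → vF m (suc k)
  a = ι (α (suc N))
  b = ι (β N)
  A = ι (α (suc k))
  R = ι (ρ k)
  X = sumTo S (λ m → l (suc N) m * w m)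
  Y = sumTo S (λ m → l N m * w m)
  Z = sumTo S (λ m → l N m * colOp w m)
  n+1<S : suc n < S
  n+1<S = ℕP.<-trans (ℕP.n<1+n (suc n)) n+2<S
  shifted : Z ≡ - A * (R * vF N k)
  shifted = begin
    Z                                             ≡⟨ sum-cong S (λ m _ → recurrence m) ⟩
    sumTo S (λ m → - A * (l N m * vF m k))        ≡⟨ sum-scale S (- A) _ ⟩
    - A * sumTo S (λ m → l N m * vF m k)          ≡⟨ cong (- A *_) (v-right-eigen n S k n+1<S) ⟩
    - A * (R * vF N k)                            ∎
    where
    recurrence : ∀ m → l N m * colOp w m ≡ - A * (l N m * vF m k)
    recurrence zero    rewrite l-col0 n = vanish (colOp w 0) A (vF 0 k)
      where
      vanish : ∀ x a y → 0ℚ * x ≡ - a * (0ℚ * y)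
      vanish = solve-∀ ℚ-ring
    recurrence (suc m) = trans (cong (l N (suc m) *_) (v-colRec k (suc m) (s≤s z≤n))) (pull (l N (suc m)) A (vF (suc m) k))
      where
      pull : ∀ x a y → x * - (a * y) ≡ - a * (x * y)
      pull = solve-∀ ℚ-ring
  isolate : ∀ a x b y → a * x ≡ (a * x + b * y) - b * y
  isolate = solve-∀ ℚ-ring
  collect : ∀ f a r v b u → f * (- a * (r * v)) - b * (f * r * u) ≡ f * r * (- (a * v) - b * u)
  collect = solve-∀ ℚ-ring
  cancel : ∀ q a x b y → q * (a * x + b * y - b * y) ≡ a * (q * x)
  cancel = solve-∀ ℚ-ring

UL≡DU : ∀ N (i j : Fin N) → (U N · L N) i j ≡ (D N · U N) i j
UL≡DU N i j = begin
  (U N · L N) i j                            ≡⟨ mat-product N u l i j u-col0 ⟩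
  sumTo (suc N) (λ m → σ * c n m * l m k)    ≡⟨ sum-cong (suc N) (λ m _ → *-assoc σ (c n m) (l m k)) ⟩
  sumTo (suc N) (λ m → σ * (c n m * l m k))  ≡⟨ sum-scale (suc N) σ _ ⟩
  σ * sumTo (suc N) (λ m → c n m * l m k)    ≡⟨ cong (σ *_) (c-left-eigen (toℕ i) (suc N) k (s≤s (toℕ<n i))) ⟩
  σ * (ι (ρ n) * c n k)                      ≡⟨ swap σ (ι (ρ n)) (c n k) ⟩
  ι (ρ n) * u n k                            ≡⟨ diag-mulˡ N u i j ⟨
  (D N · U N) i j                            ∎
  where
  open ≡-Reasoning
  n = suc (toℕ i)
  k = suc (toℕ j)
  σ = sgn n * inv ((2 ℕ.* n) !)
  u-col0 : u n 0 * l 0 k ≡ 0ℚ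
  u-col0 = trans (cong (λ z → σ * z * l 0 k) (c-col0 n)) (trans (cong (_* l 0 k) (*-zeroʳ σ)) (*-zeroˡ (l 0 k)))
  swap : ∀ s r x → s * (r * x) ≡ r * (s * x)
  swap = solve-∀ ℚ-ring

LV≡VD : ∀ N (i j : Fin N) → (L N · V N) i j ≡ (V N · D N) i j
LV≡VD N i j = begin
  (L N · V N) i j                         ≡⟨ mat-product N l v i j (trans (cong (_* v 0 k) (l-col0 (toℕ i))) (*-zeroˡ (v 0 k))) ⟩
  sumTo (suc N) (λ m → l n m * v m k)     ≡⟨ sum-cong (suc N) (λ m _ → cong (l n m *_) (v≡vF m k (s≤s z≤n))) ⟩
  sumTo (suc N) (λ m → l n m * vF m k)    ≡⟨ v-right-eigen (toℕ i) (suc N) k (s≤s (toℕ<n i)) ⟩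
  ι (ρ k) * vF n k                        ≡⟨ trans (*-comm (ι (ρ k)) (vF n k)) (cong (_* ι (ρ k)) (sym (v≡vF n k (s≤s z≤n)))) ⟩
  v n k * ι (ρ k)                         ≡⟨ diag-mulʳ N v i j ⟨
  (V N · D N) i j                         ∎
  where
  open ≡-Reasoning
  n = suc (toℕ i)
  k = suc (toℕ j)

proposition2p8 : (N : ℕ) →
    ((i j : Fin N) → (U N · L N) i j ≡ (D N · U N) i j) ×
    ((i j : Fin N) → (L N · V N) i j ≡ (V N · D N) i j)
proposition2p8 N = UL≡DU N , LV≡VD N
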